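{- Let $n\geq 1$ and let $\lambda$ be a partition of $n$ having $k_j$ parts of size $j$ ($1\le j\le n$) and $k=\sum_j k_j$ parts in total. Let $P_{\lambda,n}$ be the number of polygonal dissections of type $\lambda$ of a fixed convex $(n+2)$-gon. For a sequence $\mathbf r=(r_0,r_1,\dots,r_m)$ let $T_{\mathbf r,m}$ be the number of rooted plane trees on $m+1$ vertices with downdegree sequence $\mathbf r$. Then $P_{\lambda,n}=T_{\mathbf r,m}$ for $\mathbf r=(n+1,0,k_1,k_2,\dots,k_n)$ (padded with zeros to length $m+1$) and $m=n+k$.
   Context: A polygonal dissection of a convex polygon is the union of the polygon with a set of pairwise non-crossing diagonals; the regions it creates are convex polygons. A dissection of an $(n+2)$-gon is of type $\lambda$ (for $\lambda$ a partition of $n$ with $k_j$ parts of size $j$) if its regions consist of exactly $k_j$ regions that are $(j+2)$-gons, for each $j$. A rooted plane tree is a plane (ordered) tree with a distinguished root vertex; its downdegree sequence $(r_0,r_1,\dots)$ records in $r_j$ the number of vertices having exactly $j$ neighbors farther from the root than the vertex itself. -}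

module Defs where

open import Data.Nat using (ℕ; zero; suc; _+_; _*_; _≤_; _<_)
open import Data.Fin as F using (Fin; toℕ)
open import Data.Fin.Subset using (Subset; _∈_; _∉_; ∣_∣)
open import Data.Vec using (Vec; lookup; tabulate)
import Data.Vec as V
open import Data.List using (List; []; _∷_; length)
import Data.List as L
open import Data.List.Relation.Unary.Unique.Propositional using (Unique)
import Data.List.Membership.Propositional as LM
open import Data.Bool using (Bool; true; false; if_then_else_)
open import Data.Product using (Σ; _×_; _,_)
open import Data.Sum using (_⊎_)
open import Relation.Binary.PropositionalEquality using (_≡_)
open import Relation.Nullary using (¬_; does)
open import Function.Bundles using (_⇔_)
import Data.Nat as N

record Count {A : Set} (P : A → Set) (c : ℕ) : Set where
  field
    elems    : List A
    unique   : Unique elems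
    complete : ∀ x → P x ⇔ (x LM.∈ elems)
    size     : length elems ≡ c

-- Partitions of n, given by multiplicities: k is (k_1, …, k_n), where
-- `lookup k i` is the number of parts of size toℕ i + 1.

sumᵥ : ∀ {n} → Vec ℕ n → ℕ
sumᵥ = V.foldr _ _+_ 0

IsPartition : (n : ℕ) → Vec ℕ n → Set
IsPartition n k = sumᵥ (tabulate (λ (i : Fin n) → (toℕ i + 1) * lookup k i)) ≡ n

numParts : ∀ {n} → Vec ℕ n → ℕ
numParts = sumᵥ

-- Polygonal dissections of the convex (n+2)-gon with vertices
-- 0, 1, …, n+1 in cyclic order.  Sides: {i, i+1} and {0, n+1}.
-- A set of diagonals is stored as a Boolean adjacency matrix D;
-- D contains the diagonal {i,j} (i < j) iff entry (i , j) is true.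

Diagonals : ℕ → Set
Diagonals n = Vec (Vec Bool (suc (suc n))) (suc (suc n))

Has : ∀ {n} → Diagonals n → Fin (suc (suc n)) → Fin (suc (suc n)) → Set
Has D i j = lookup (lookup D i) j ≡ true

IsDiagonal : (n : ℕ) → Fin (suc (suc n)) → Fin (suc (suc n)) → Set
IsDiagonal n i j = (suc (toℕ i) < toℕ j) × ¬ (toℕ i ≡ 0 × toℕ j ≡ suc n)

Cross : ∀ {m} → Fin m → Fin m → Fin m → Fin m → Set
Cross a b c d = (toℕ a < toℕ c × toℕ c < toℕ b × toℕ b < toℕ d)

IsDissection : (n : ℕ) → Diagonals n → Set
IsDissection n D =
  (∀ i j → Has D i j → IsDiagonal n i j) ×
  (∀ a b c d → Has D a b → Has D c d → ¬ Cross a b c d)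

Edge : ∀ {n} → Diagonals n → Fin (suc (suc n)) → Fin (suc (suc n)) → Set
Edge {n} D i j = (toℕ j ≡ suc (toℕ i)) ⊎ (toℕ i ≡ 0 × toℕ j ≡ suc n) ⊎ Has D i j

-- i < j are cyclically consecutive elements of the vertex set S
Consec : ∀ {m} → Subset m → Fin m → Fin m → Set
Consec S i j =
  (∀ l → toℕ i < toℕ l → toℕ l < toℕ j → l ∉ S) ⊎
  ((∀ l → toℕ l < toℕ i → l ∉ S) × (∀ l → toℕ j < toℕ l → l ∉ S))

-- S is the vertex set of a region of the dissection D: a convex polygon
-- (at least 3 vertices) whose boundary edges (cyclically consecutive
-- vertices) are edges of D and which is not cut by any edge of D
-- (no two non-consecutive vertices of S are joined).
IsRegion : ∀ {n} → Diagonals n → Subset (suc (suc n)) → Set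
IsRegion D S =
  (3 ≤ ∣ S ∣) ×
  (∀ i j → i ∈ S → j ∈ S → toℕ i < toℕ j → (Edge D i j ⇔ Consec S i j))

-- D is of type λ = k: for each j (1 ≤ j ≤ n) it has exactly k_j regions
-- that are (j+2)-gons.  (Index i : Fin n stands for j = toℕ i + 1.)
HasType : (n : ℕ) → Vec ℕ n → Diagonals n → Set
HasType n k D =
  ∀ (i : Fin n) → Count (λ S → IsRegion D S × ∣ S ∣ ≡ toℕ i + 3) (lookup k i)

DissectionOfType : (n : ℕ) → Vec ℕ n → Diagonals n → Set
DissectionOfType n k D = IsDissection n D × HasType n k D

data Tree : Set where
  node : List Tree → Tree

mutual
  vertices : Tree → ℕ
  vertices (node ts) = suc (verticesF ts)

  verticesF : List Tree → ℕ
  verticesF []       = 0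
  verticesF (t ∷ ts) = vertices t + verticesF ts

mutual
  degCount : ℕ → Tree → ℕ
  degCount d (node ts) =
    (if does (length ts N.≟ d) then 1 else 0) + degCountF d ts

  degCountF : ℕ → List Tree → ℕ
  degCountF d []       = 0
  degCountF d (t ∷ ts) = degCount d t + degCountF d ts

downdegSeq : (m : ℕ) → Tree → Vec ℕ (suc m)
downdegSeq m t = tabulate (λ (j : Fin (suc m)) → degCount (toℕ j) t)

TreeWith : (m : ℕ) → Vec ℕ (suc m) → Tree → Set
TreeWith m r t = (vertices t ≡ suc m) × (downdegSeq m t ≡ r)

rEntry : ∀ {n} → Vec ℕ n → ℕ → ℕ
rEntry {n} k 0 = suc n
rEntry k 1 = 0
rEntry {n} k (suc (suc j)) with j N.<? n
... | Relation.Nullary.yes p = lookup k (F.fromℕ< p)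
... | Relation.Nullary.no _ = 0

rSeq : ∀ {n} → Vec ℕ n → (m : ℕ) → Vec ℕ (suc m)
rSeq k m = tabulate (λ (j : Fin (suc m)) → rEntry k (toℕ j))

module Submission where

-- The bijection goes from trees to dissections.  Number the n + 1 leaves of a
-- tree without unary vertices 0, …, n from left to right; every vertex then
-- covers an interval [o, o + ℓ] of polygon vertices (ℓ = number of its leaves),
-- the root covering [0, n + 1].  Each non-root vertex with ℓ ≥ 2 contributes the
-- diagonal {o, o + ℓ}; leaves correspond to the sides {i, i + 1}.  A vertex with
-- d children becomes the region whose corners are the d + 1 end points of its
-- children's intervals, so (j + 2)-gons correspond to vertices of downdegree j + 1.

open import Defs
open import Data.Nat using (ℕ; _+_; _≤_)
open import Data.Vec using (Vec)
open import Data.Product using (Σ; _×_; _,_)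
open import Relation.Binary.PropositionalEquality using (_≡_)

module Counting where
  open import Data.Nat using (_≤_; z≤n; s≤s)
  open import Data.Nat.Properties using (≤-trans; ≤-reflexive; ≤-antisym)
  open import Data.List using (List; []; _∷_; length; _++_; map)
  open import Data.List.Properties using (length-map; length-++-sucʳ)
  open import Data.List.Membership.Propositional using (_∈_)
  open import Data.List.Membership.Propositional.Properties using (∈-∃++; ∈-++⁻; ∈-++⁺ˡ; ∈-++⁺ʳ; ∈-map⁺; ∈-map⁻)
  open import Data.List.Relation.Unary.Any using (here; there)
  import Data.List.Relation.Unary.All as All
  open import Data.List.Relation.Unary.Unique.Propositional using (Unique; []; _∷_)
  open import Data.Product using (Σ; _×_; _,_)
  open import Data.Sum using (inj₁; inj₂)
  open import Data.Empty using (⊥-elim)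
  open import Relation.Binary.PropositionalEquality using (_≡_; _≢_; refl; sym; trans)
  open import Function.Bundles using (mk⇔; Equivalence)
  open import Defs using (Count)

  unique-length-≤ : ∀ {A : Set} {xs ys : List A} → Unique xs → (∀ {z} → z ∈ xs → z ∈ ys) →
    length xs ≤ length ys
  unique-length-≤ {xs = []} u sub = z≤n
  unique-length-≤ {xs = x ∷ xs} (x∉ ∷ u) sub with ∈-∃++ (sub (here refl))
  ... | as , bs , refl = ≤-trans (s≤s (unique-length-≤ u sub')) (≤-reflexive (sym (length-++-sucʳ as x bs)))
    where
    sub' : ∀ {z} → z ∈ xs → z ∈ as ++ bs
    sub' {z} z∈ with ∈-++⁻ as (sub (there z∈))
    ... | inj₁ p = ∈-++⁺ˡ p
    ... | inj₂ (here refl) = ⊥-elim (All.lookup x∉ z∈ refl)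
    ... | inj₂ (there p) = ∈-++⁺ʳ as p

  count-unique : ∀ {A : Set} {P : A → Set} {a b} → Count P a → Count P b → a ≡ b
  count-unique C₁ C₂ = trans (sym (Count.size C₁)) (trans
    (≤-antisym (unique-length-≤ (Count.unique C₁) (included C₁ C₂))
               (unique-length-≤ (Count.unique C₂) (included C₂ C₁)))
    (Count.size C₂))
    where
    included : ∀ {a b} (C : Count _ a) (C' : Count _ b) → ∀ {z} → z ∈ Count.elems C → z ∈ Count.elems C'
    included C C' {z} z∈ = Equivalence.to (Count.complete C' z) (Equivalence.from (Count.complete C z) z∈)

  count-transfer : ∀ {A B : Set} {P : A → Set} {Q : B → Set} {c} (f : A → B) →
    (∀ x → P x → Q (f x)) → (∀ y → Q y → Σ A λ x → P x × f x ≡ y) →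
    (∀ x x' → P x → P x' → f x ≡ f x' → x ≡ x') → Count P c → Count Q c
  count-transfer {P = P} {Q} f PQ QP inj C = record
    { elems = map f es ; unique = map-unique (λ z → z) (Count.unique C)
    ; complete = λ y → mk⇔ (to y) (from y)
    ; size = trans (length-map f es) (Count.size C) }
    where
    es = Count.elems C
    inP : ∀ {x} → x ∈ es → P x
    inP {x} x∈ = Equivalence.from (Count.complete C x) x∈
    to : ∀ y → Q y → y ∈ map f es
    to y q with QP y q
    ... | x , px , refl = ∈-map⁺ f (Equivalence.to (Count.complete C x) px)
    from : ∀ y → y ∈ map f es → Q y
    from y y∈ with ∈-map⁻ f y∈
    ... | x , x∈ , refl = PQ x (inP x∈)
    -- f is only injective on P, so uniqueness is preserved for sublists of es
    map-unique : ∀ {xs} → (∀ {x} → x ∈ xs → x ∈ es) → Unique xs → Unique (map f xs)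
    map-unique {[]} sub [] = []
    map-unique {x ∷ xs} sub (x∉ ∷ u) =
      All.tabulate (λ {w} w∈ → distinct w (∈-map⁻ f w∈)) ∷ map-unique (λ z∈ → sub (there z∈)) u
      where
      distinct : ∀ w → (Σ _ λ y → y ∈ xs × w ≡ f y) → f x ≢ w
      distinct w (y , y∈ , refl) eq = All.lookup x∉ y∈ (inj x y (inP (sub (here refl))) (inP (sub (there y∈))) eq)

  count-cong : ∀ {A : Set} {P Q : A → Set} {c} → (∀ x → P x → Q x) → (∀ x → Q x → P x) →
    Count P c → Count Q c
  count-cong to from = count-transfer (λ x → x) to (λ y q → y , from y q , refl) (λ x x' _ _ e → e)

-- There are only finitely many plane trees with a given number of vertices,
-- so every set of trees cut out by a decidable condition on a bounded number
-- of vertices has a count.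
module TreeEnumeration where
  open import Data.Nat using (ℕ; zero; suc; _≤_; z≤n; s≤s; _≟_)
  open import Data.Nat.Properties using (≤-trans; ≤-refl; ≤-reflexive; m≤m+n; m≤n+m; +-monoˡ-≤; +-monoʳ-≤)
  open import Data.List using (List; []; _∷_; length; map; filter; deduplicate; cartesianProductWith)
  open import Data.List.Membership.Propositional using (_∈_)
  open import Data.List.Membership.Propositional.Properties
    using (∈-cartesianProductWith⁺; ∈-map⁺; ∈-filter⁺; ∈-filter⁻; ∈-deduplicate⁺; ∈-deduplicate⁻)
  open import Data.List.Relation.Unary.Any using (here; there)
  open import Data.List.Relation.Unary.All using (All; []; _∷_)
  import Data.List.Relation.Unary.Unique.DecPropositional.Properties as UniqueDec
  open import Data.Product using (Σ; _,_; proj₁; proj₂)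
  open import Relation.Binary.PropositionalEquality using (refl)
  open import Relation.Binary.Definitions using (DecidableEquality)
  open import Relation.Nullary using (Dec; yes; no)
  open import Relation.Nullary.Decidable using (_×-dec_)
  open import Function.Bundles using (mk⇔)
  import Data.Vec.Properties as VecP
  open import Defs

  mutual
    _≟T_ : DecidableEquality Tree
    node ts ≟T node us with ts ≟F us
    ... | yes refl = yes refl
    ... | no ne = no λ { refl → ne refl }

    _≟F_ : DecidableEquality (List Tree)
    [] ≟F [] = yes refl
    [] ≟F (_ ∷ _) = no λ ()
    (_ ∷ _) ≟F [] = no λ ()
    (t ∷ ts) ≟F (u ∷ us) with t ≟T u | ts ≟F us
    ... | yes refl | yes refl = yes refl
    ... | no ne | _ = no λ { refl → ne refl }
    ... | _ | no ne = no λ { refl → ne refl }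

  listsBelow : List Tree → ℕ → List (List Tree)
  listsBelow xs zero = [] ∷ []
  listsBelow xs (suc w) = [] ∷ cartesianProductWith _∷_ xs (listsBelow xs w)

  listsBelow-complete : ∀ xs w ts → All (_∈ xs) ts → length ts ≤ w → ts ∈ listsBelow xs w
  listsBelow-complete xs zero [] a le = here refl
  listsBelow-complete xs (suc w) [] a le = here refl
  listsBelow-complete xs (suc w) (t ∷ ts) (p ∷ a) (s≤s le) =
    there (∈-cartesianProductWith⁺ _∷_ p (listsBelow-complete xs w ts a le))

  treesBelow : ℕ → List Tree
  treesBelow zero = []
  treesBelow (suc f) = map node (listsBelow (treesBelow f) f)

  vertices≥1 : ∀ t → 1 ≤ vertices t
  vertices≥1 (node ts) = s≤s z≤n

  mutual
    treesBelow-complete : ∀ t f → vertices t ≤ f → t ∈ treesBelow f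
    treesBelow-complete (node ts) (suc f) (s≤s le) =
      ∈-map⁺ node (listsBelow-complete _ f ts (treesBelow-completeF ts f le) (children-fewer ts f le))

    treesBelow-completeF : ∀ ts f → verticesF ts ≤ f → All (_∈ treesBelow f) ts
    treesBelow-completeF [] f le = []
    treesBelow-completeF (t ∷ ts) f le =
      treesBelow-complete t f (≤-trans (m≤m+n _ _) le) ∷ treesBelow-completeF ts f (≤-trans (m≤n+m _ _) le)

    children-fewer : ∀ ts f → verticesF ts ≤ f → length ts ≤ f
    children-fewer [] f le = z≤n
    children-fewer (t ∷ ts) f le = ≤-trans (+-monoˡ-≤ (length ts) (vertices≥1 t))
      (≤-trans (+-monoʳ-≤ (vertices t) (children-fewer ts _ ≤-refl)) le)

  treeWith? : ∀ m r t → Dec (TreeWith m r t)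
  treeWith? m r t = vertices t ≟ suc m ×-dec VecP.≡-dec _≟_ (downdegSeq m t) r

  count-trees : ∀ m r → Σ ℕ (Count (TreeWith m r))
  count-trees m r = length es , record
    { elems = es ; unique = UniqueDec.deduplicate-! _≟T_ candidates
    ; complete = λ t → mk⇔
        (λ tw → ∈-deduplicate⁺ _≟T_ (∈-filter⁺ (treeWith? m r)
                  (treesBelow-complete t (suc m) (≤-reflexive (proj₁ tw))) tw))
        (λ t∈ → proj₂ (∈-filter⁻ (treeWith? m r) {xs = treesBelow (suc m)} (∈-deduplicate⁻ _≟T_ candidates t∈)))
    ; size = refl }
    where
    candidates = filter (treeWith? m r) (treesBelow (suc m))
    es = deduplicate _≟T_ candidates

module Search where
  open import Data.Nat using (ℕ; zero; suc; _+_; _≤_; _<_; s≤s; _≤?_; _<?_)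
  open import Data.Nat.Properties using (<-irrefl; <-≤-trans; ≮⇒≥; <⇒≤; <-cmp; n≤0⇒n≡0; m≤n⇒m<n∨m≡n; +-identityʳ; +-suc)
  open import Data.Product using (Σ; _×_; _,_; proj₂)
  open import Data.Sum using (_⊎_; inj₁; inj₂)
  open import Data.Empty using (⊥-elim)
  open import Relation.Binary.PropositionalEquality using (_≡_; refl; sym; trans; subst)
  open import Relation.Nullary using (Dec; yes; no; ¬_; _×-dec_)
  open import Relation.Binary.Definitions using (tri<; tri≈; tri>)

  least : (P : ℕ → Set) → (∀ w → Dec (P w)) → ∀ w → P w → Σ ℕ λ m → P m × (∀ z → z < m → ¬ P z)
  least P P? w pw = go w 0 refl (λ z ())
    where
    -- k candidates below have been rejected, r remain before the known witness
    go : ∀ r k → k + r ≡ w → (∀ z → z < k → ¬ P z) → Σ ℕ λ m → P m × (∀ z → z < m → ¬ P z)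
    go r k e nb with P? k
    ... | yes pk = k , pk , nb
    go zero k e nb | no npk = ⊥-elim (npk (subst P (trans (sym e) (+-identityʳ k)) pw))
    go (suc r) k e nb | no npk = go r (suc k) (trans (sym (+-suc k r)) e) nb'
      where
      nb' : ∀ z → z < suc k → ¬ P z
      nb' z (s≤s z≤k) with m≤n⇒m<n∨m≡n z≤k
      ... | inj₁ lt = nb z lt
      ... | inj₂ refl = npk

  greatest : (P : ℕ → Set) → (∀ w → Dec (P w)) → ∀ w B → P w → (∀ z → P z → z ≤ B) →
    Σ ℕ λ m → P m × (∀ z → m < z → ¬ P z)
  greatest P P? w zero pw bd = 0 , subst P (n≤0⇒n≡0 (bd w pw)) pw , λ z lt pz → <-irrefl refl (<-≤-trans lt (bd z pz))
  greatest P P? w (suc B) pw bd with P? (suc B)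
  ... | yes pb = suc B , pb , λ z lt pz → <-irrefl refl (<-≤-trans lt (bd z pz))
  ... | no npb = greatest P P? w B pw (λ z pz → lower z pz (m≤n⇒m<n∨m≡n (bd z pz)))
    where
    lower : ∀ z → P z → z < suc B ⊎ z ≡ suc B → z ≤ B
    lower z pz (inj₁ (s≤s x)) = x
    lower z pz (inj₂ refl) = ⊥-elim (npb pz)

  largest : (P : ℕ → Set) → (∀ w → Dec (P w)) → ∀ v b → v < b → P (suc v) →
    Σ ℕ λ d → v < d × d ≤ b × P d × (∀ w → d < w → w ≤ b → ¬ P w)
  largest P P? v b v<b p₁ with greatest (λ w → P w × w ≤ b) Q? (suc v) b (p₁ , v<b) (λ _ q → proj₂ q)
    where
    Q? : ∀ w → Dec (P w × w ≤ b)
    Q? w = P? w ×-dec w ≤? b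
  ... | d , (pd , d≤b) , above = d , ≮⇒≥ (λ d<v+1 → above (suc v) d<v+1 (p₁ , v<b)) , d≤b , pd ,
    λ w d<w w≤b pw → above w d<w (pw , w≤b)

  gap-neighbours : ∀ {M : ℕ → Set} → (∀ z → Dec (M z)) → ∀ {a z b} → M a → M b → a < z → z < b → ¬ M z →
    Σ ℕ λ x → Σ ℕ λ y → M x × M y × x < z × z < y × (∀ l → x < l → l < y → ¬ M l) ×
      (∀ w → M w → w < z → w ≤ x) × (∀ w → M w → z < w → y ≤ w)
  gap-neighbours {M} M? {a} {z} {b} ma mb a<z z<b nz
    with greatest (λ m → M m × m < z) (λ m → M? m ×-dec m <? z) a z (ma , a<z) (λ w pw → <⇒≤ (proj₂ pw))
       | least (λ m → M m × z < m) (λ m → M? m ×-dec z <? m) b (mb , z<b)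
  ... | x , (mx , x<z) , aboveX | y , (my , z<y) , belowY =
    x , y , mx , my , x<z , z<y , between , (λ w mw w<z → ≮⇒≥ (λ x<w → aboveX w x<w (mw , w<z))) ,
    (λ w mw z<w → ≮⇒≥ (λ w<y → belowY w w<y (mw , z<w)))
    where
    between : ∀ l → x < l → l < y → ¬ M l
    between l x<l l<y ml with <-cmp l z
    ... | tri< l<z _ _ = aboveX l x<l (ml , l<z)
    ... | tri≈ _ refl _ = nz ml
    ... | tri> _ _ z<l = belowY l l<y (ml , z<l)

-- Number the leaves of a plane tree 0, 1, … from left to
-- right.  Placed at offset a, a tree t covers the leaf interval [a, a + leaves t],
-- read as the polygon vertices a, …, a + leaves t.  Every non-leaf child c of a
-- vertex covering more than one leaf yields the chord {o, o + leaves c} of its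
-- own interval: these chords are the diagonals the tree generates.
module LeafIntervals where
  open import Defs
  open import Data.Nat
  open import Data.Nat.Properties
  open import Data.List using (List; []; _∷_; length)
  open import Data.Product using (_×_; _,_; proj₁; proj₂)
  open import Data.Sum using (_⊎_; inj₁; inj₂)
  open import Data.Empty
  open import Data.Unit using (⊤)
  open import Relation.Binary.PropositionalEquality
  open import Relation.Nullary

  mutual
    leaves : Tree → ℕ
    leaves (node []) = 1
    leaves (node (t ∷ ts)) = leaves t + leavesF ts

    leavesF : List Tree → ℕ
    leavesF [] = 0
    leavesF (t ∷ ts) = leaves t + leavesF ts

  leaves≥1 : ∀ t → 1 ≤ leaves t
  leaves≥1 (node []) = s≤s z≤n
  leaves≥1 (node (t ∷ ts)) = ≤-trans (leaves≥1 t) (m≤m+n _ _)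

  -- `Slot ts a c o`: in the forest ts placed at offset a, the tree c occurs and
  -- starts at leaf o (the children are placed side by side)
  data Slot : List Tree → ℕ → Tree → ℕ → Set where
    first : ∀ {c cs a} → Slot (c ∷ cs) a c a
    later : ∀ {c cs a c' o} → Slot cs (a + leaves c) c' o → Slot (c ∷ cs) a c' o

  data Gen : Tree → ℕ → ℕ → ℕ → Set where
    gen-span : ∀ {ts a c o} → Slot ts a c o → 2 ≤ leaves c → Gen (node ts) a o (o + leaves c)
    gen-inside : ∀ {ts a c o i j} → Slot ts a c o → Gen c o i j → Gen (node ts) a i j

  mutual
    NoUnary : Tree → Set
    NoUnary (node ts) = (length ts ≢ 1) × NoUnaryF ts

    NoUnaryF : List Tree → Set
    NoUnaryF [] = ⊤
    NoUnaryF (t ∷ ts) = NoUnary t × NoUnaryF ts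

  slot-noUnary : ∀ {ts a c o} → NoUnaryF ts → Slot ts a c o → NoUnary c
  slot-noUnary v first = proj₁ v
  slot-noUnary v (later s) = slot-noUnary (proj₂ v) s

  slot-bounds : ∀ {ts a c o} → Slot ts a c o → a ≤ o × o + leaves c ≤ a + leavesF ts
  slot-bounds {c ∷ cs} {a} first = ≤-refl , ≤-trans (m≤m+n (a + leaves c) (leavesF cs)) (≤-reflexive (+-assoc a _ _))
  slot-bounds {c ∷ cs} {a} (later s) with slot-bounds s
  ... | p , q = ≤-trans (m≤m+n a _) p , ≤-trans q (≤-reflexive (+-assoc a (leaves c) (leavesF cs)))

  slot-leaves-node : ∀ {ts a c o} → Slot ts a c o → leaves (node ts) ≡ leavesF ts
  slot-leaves-node first = refl
  slot-leaves-node (later _) = refl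

  slot-bounds-node : ∀ {ts a c o} → Slot ts a c o → a ≤ o × o + leaves c ≤ a + leaves (node ts)
  slot-bounds-node s rewrite slot-leaves-node s = slot-bounds s

  slot-full : ∀ {ts a c o} → Slot ts a c o → o ≡ a → leaves c ≡ leavesF ts → length ts ≡ 1
  slot-full {c ∷ []} first e1 e2 = refl
  slot-full {c ∷ c' ∷ cs} first e1 e2 = ⊥-elim (<-irrefl e2 (begin-strict
     leaves c <⟨ m<m+n (leaves c) (≤-trans (leaves≥1 c') (m≤m+n _ _)) ⟩ leaves c + leavesF (c' ∷ cs) ∎))
    where open ≤-Reasoning
  slot-full {c ∷ cs} {a} (later s) refl e2 = ⊥-elim (<-irrefl refl (begin-strict
     a <⟨ m<m+n a (leaves≥1 c) ⟩ a + leaves c ≤⟨ proj₁ (slot-bounds s) ⟩ a ∎))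
    where open ≤-Reasoning

  slot-disjoint : ∀ {ts a c o c' o'} → Slot ts a c o → Slot ts a c' o' →
    (o ≡ o' × c ≡ c') ⊎ (o + leaves c ≤ o') ⊎ (o' + leaves c' ≤ o)
  slot-disjoint first first = inj₁ (refl , refl)
  slot-disjoint first (later s') = inj₂ (inj₁ (proj₁ (slot-bounds s')))
  slot-disjoint (later s) first = inj₂ (inj₂ (proj₁ (slot-bounds s)))
  slot-disjoint (later s) (later s') = slot-disjoint s s'

  gen-bounds : ∀ {t a i j} → NoUnary t → Gen t a i j →
    a ≤ i × 2 + i ≤ j × j ≤ a + leaves t × ¬ (i ≡ a × j ≡ a + leaves t)
  gen-bounds {node ts} {a} (v1 , v2) (gen-span {c = c} {o} s l2) with slot-bounds-node s
  ... | p , q = p , ≤-trans (≤-reflexive (+-comm 2 o)) (+-monoʳ-≤ o l2) , q , nf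
    where
    nf : ¬ (o ≡ a × o + leaves c ≡ a + leaves (node ts))
    nf (e1 , e2) = v1 (slot-full s e1 (+-cancelˡ-≡ o _ _ (trans e2 (trans (cong (_+ _) (sym e1)) (cong (o +_) (slot-leaves-node s))))))
  gen-bounds {node ts} {a} (v1 , v2) (gen-inside {c = c} {o} {i} {j} s g) with slot-bounds-node s | gen-bounds (slot-noUnary v2 s) g
  ... | p , q | p' , q' , r' , _ = ≤-trans p p' , q' , ≤-trans r' q , nf
    where
    nf : ¬ (i ≡ a × j ≡ a + leaves (node ts))
    nf (refl , e2) = v1 (slot-full s (≤-antisym p' p) (≤-antisym
       (+-cancelˡ-≤ o _ _ (≤-trans q (≤-reflexive (trans (cong (_+ _) (≤-antisym p p')) (cong (o +_) (slot-leaves-node s))))))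
       (+-cancelˡ-≤ o _ _ (≤-trans (≤-reflexive (trans (cong (_+ _) (≤-antisym p' p)) (trans (sym (cong (i +_) (slot-leaves-node s))) (sym e2)))) r'))))

module Crossings where
  open import Defs
  open LeafIntervals
  open import Data.Nat
  open import Data.Nat.Properties
  open import Data.List using (List; []; _∷_)
  open import Data.Product using (Σ; _×_; _,_; proj₁; proj₂)
  open import Data.Sum using (_⊎_; inj₁; inj₂)
  open import Data.Empty
  open import Relation.Binary.PropositionalEquality
  open import Relation.Nullary

  GenSpan : Tree → ℕ → ℕ → ℕ → Set
  GenSpan c o i j = (i ≡ o × j ≡ o + leaves c × 2 ≤ leaves c) ⊎ Gen c o i j

  -- two crossing chords lying inside the intervals of two children of the same
  -- forest must lie inside the same child (distinct children have disjoint interiors)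
  crossing-sameChild : ∀ {ts a c o c' o' i j i' j'} → Slot ts a c o → Slot ts a c' o' → o ≤ i → j ≤ o + leaves c →
    o' ≤ i' → j' ≤ o' + leaves c' → (i < i' × i' < j × j < j') → (o ≡ o' × c ≡ c')
  crossing-sameChild s s' lo hi lo' hi' (c₁ , c2 , c3) with slot-disjoint s s'
  ... | inj₁ e = e
  ... | inj₂ (inj₁ le) = ⊥-elim (<-irrefl refl (≤-trans c2 (≤-trans hi (≤-trans le lo'))))
  ... | inj₂ (inj₂ le) = ⊥-elim (<-irrefl refl (≤-trans c₁ (≤-trans (<⇒≤ (<-trans c2 c3)) (≤-trans hi' (≤-trans le lo)))))

  gen-noncrossing : ∀ {t a i j i' j'} → NoUnary t → Gen t a i j → Gen t a i' j' → ¬ (i < i' × i' < j × j < j')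
  gen-noncrossing {node ts} v (gen-span s l) (gen-span s' l') cr with crossing-sameChild s s' ≤-refl ≤-refl ≤-refl ≤-refl cr
  ... | refl , refl = <-irrefl refl (proj₁ cr)
  gen-noncrossing {node ts} v (gen-span s l) (gen-inside s' h') cr with gen-bounds (slot-noUnary (proj₂ v) s') h'
  ... | lo' , _ , hi' , _ with crossing-sameChild s s' ≤-refl ≤-refl lo' hi' cr
  ... | refl , refl = <-irrefl refl (≤-trans (proj₂ (proj₂ cr)) hi')
  gen-noncrossing {node ts} v (gen-inside s h) (gen-span s' l') cr with gen-bounds (slot-noUnary (proj₂ v) s) h
  ... | lo , _ , hi , _ with crossing-sameChild s s' lo hi ≤-refl ≤-refl cr
  ... | refl , refl = <-irrefl refl (≤-trans (proj₁ cr) lo)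
  gen-noncrossing {node ts} v (gen-inside s h) (gen-inside s' h') cr with gen-bounds (slot-noUnary (proj₂ v) s) h | gen-bounds (slot-noUnary (proj₂ v) s') h'
  ... | lo , _ , hi , _ | lo' , _ , hi' , _ with crossing-sameChild s s' lo hi lo' hi' cr
  ... | refl , refl = gen-noncrossing (slot-noUnary (proj₂ v) s) h h' cr

  GenForest : List Tree → ℕ → ℕ → ℕ → Set
  GenForest ts a i j = Σ Tree λ c → Σ ℕ λ o → Slot ts a c o × GenSpan c o i j

  GenForest→Gen : ∀ {ts a i j} → GenForest ts a i j → Gen (node ts) a i j
  GenForest→Gen (c , o , s , inj₁ (refl , refl , l2)) = gen-span s l2
  GenForest→Gen (c , o , s , inj₂ g) = gen-inside s g

  Gen→GenForest : ∀ {ts a i j} → Gen (node ts) a i j → GenForest ts a i j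
  Gen→GenForest (gen-span {c = c} {o} s l2) = c , o , s , inj₁ (refl , refl , l2)
  Gen→GenForest (gen-inside {c = c} {o} s g) = c , o , s , inj₂ g

  mutual
    decGen : ∀ t a i j → Dec (Gen t a i j)
    decGen (node ts) a i j with decGenForest ts a i j
    ... | yes p = yes (GenForest→Gen p)
    ... | no np = no λ g → np (Gen→GenForest g)

    decGenForest : ∀ ts a i j → Dec (GenForest ts a i j)
    decGenForest [] a i j = no λ { (_ , _ , () , _) }
    decGenForest (c ∷ cs) a i j with decGenSpan c a i j | decGenForest cs (a + leaves c) i j
    ... | yes p | _ = yes (c , a , first , p)
    ... | no _ | yes (c' , o' , s' , p') = yes (c' , o' , later s' , p')
    ... | no np | no nq = no λ { (_ , _ , first , p) → np p ; (c' , o' , later s' , p') → nq (c' , o' , s' , p') }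

    decGenSpan : ∀ c o i j → Dec (GenSpan c o i j)
    decGenSpan c o i j with i ≟ o | j ≟ o + leaves c | 2 ≤? leaves c | decGen c o i j
    ... | _ | _ | _ | yes g = yes (inj₂ g)
    ... | yes p | yes q | yes r | no _ = yes (inj₁ (p , q , r))
    ... | no p | _ | _ | no g = no λ { (inj₁ (x , _)) → p x ; (inj₂ x) → g x }
    ... | yes _ | no q | _ | no g = no λ { (inj₁ (_ , x , _)) → q x ; (inj₂ x) → g x }
    ... | yes _ | yes _ | no r | no g = no λ { (inj₁ (_ , _ , x)) → r x ; (inj₂ x) → g x }

-- A tree without unary vertices is determined by its number of leaves and the
-- set of chords it generates (induction on the tree, comparing the first
-- children: the first child's span is the longest generated chord starting at a).
module Injectivity where
  open import Defs
  open LeafIntervals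
  open Crossings
  open import Data.Nat
  open import Data.Nat.Properties
  open import Data.List using ([]; _∷_)
  open import Data.Product using (_×_; _,_; proj₁; proj₂)
  open import Data.Sum using (inj₁; inj₂)
  open import Data.Empty
  open import Relation.Binary.PropositionalEquality
  open import Relation.Nullary
  open import Relation.Binary.Definitions using (tri<; tri≈; tri>)

  genSpan-bounds : ∀ {c o i j} → NoUnary c → GenSpan c o i j → o ≤ i × i < j × j ≤ o + leaves c
  genSpan-bounds v (inj₁ (refl , refl , l2)) = ≤-refl , ≤-trans (≤-reflexive (+-comm 1 _)) (+-monoʳ-≤ _ (≤-trans (s≤s z≤n) l2)) , ≤-refl
  genSpan-bounds v (inj₂ g) with gen-bounds v g
  ... | p , q , r , _ = p , ≤-trans (s≤s (m≤n+m _ 1)) q , r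

  leavesF-zero : ∀ ts → leavesF ts ≡ 0 → ts ≡ []
  leavesF-zero [] e = refl
  leavesF-zero (t ∷ ts) e = ⊥-elim (<-irrefl (sym e) (≤-trans (leaves≥1 t) (m≤m+n _ _)))

  single-leaf : ∀ t → NoUnary t → leaves t ≡ 1 → t ≡ node []
  single-leaf (node []) v e = refl
  single-leaf (node (c ∷ cs)) v e with leavesF-zero cs (+-cancelˡ-≡ 1 _ _ (trans (cong (_+ leavesF cs) (sym (≤-antisym (≤-trans (m≤m+n _ _) (≤-reflexive e)) (leaves≥1 c)))) e))
  ... | refl = ⊥-elim (proj₁ v refl)

  Sub₂ : (ℕ → ℕ → Set) → (ℕ → ℕ → Set) → Set
  Sub₂ P Q = ∀ i j → P i j → Q i j


  -- if the chords of the forest c' ∷ cs' are among those of c ∷ cs, then c' covers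
  -- no more leaves than c: the span of c' would otherwise be a chord of c ∷ cs
  -- starting at a that is longer than anything it generates
  firstChild-notLarger : ∀ a c cs c' cs' → NoUnaryF (c ∷ cs) → Sub₂ (GenForest (c' ∷ cs') a) (GenForest (c ∷ cs) a) → ¬ (leaves c < leaves c')
  firstChild-notLarger a c cs c' cs' v g lt with g a (a + leaves c') (c' , a , first , inj₁ (refl , refl , ≤-trans (s≤s (leaves≥1 c)) lt))
  ... | _ , _ , first , inj₁ (_ , e , _) = <-irrefl (+-cancelˡ-≡ a _ _ (sym e)) lt
  ... | _ , _ , first , inj₂ h = <-irrefl refl (≤-trans (+-monoʳ-< a lt) (proj₁ (proj₂ (proj₂ (gen-bounds (proj₁ v) h)))))
  ... | c'' , o , later s , sg = <-irrefl refl (≤-trans (m<m+n a (leaves≥1 c)) (≤-trans (proj₁ (slot-bounds s)) (proj₁ (genSpan-bounds (slot-noUnary (proj₂ v) s) sg))))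

  firstChild-leaves : ∀ a c cs c' cs' → NoUnaryF (c ∷ cs) → NoUnaryF (c' ∷ cs') → Sub₂ (GenForest (c ∷ cs) a) (GenForest (c' ∷ cs') a) →
    Sub₂ (GenForest (c' ∷ cs') a) (GenForest (c ∷ cs) a) → leaves c ≡ leaves c'
  firstChild-leaves a c cs c' cs' v v' f g with <-cmp (leaves c) (leaves c')
  ... | tri< lt _ _ = ⊥-elim (firstChild-notLarger a c cs c' cs' v g lt)
  ... | tri≈ _ eq _ = eq
  ... | tri> _ _ gt = ⊥-elim (firstChild-notLarger a c' cs' c cs v' f gt)

  firstChild-sub : ∀ a c cs c' cs' → NoUnaryF (c ∷ cs) → NoUnaryF (c' ∷ cs') → leaves c ≡ leaves c' →
    Sub₂ (GenForest (c ∷ cs) a) (GenForest (c' ∷ cs') a) → Sub₂ (Gen c a) (Gen c' a)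
  firstChild-sub a c cs c' cs' v v' eq f i j h with gen-bounds (proj₁ v) h | f i j (c , a , first , inj₂ h)
  ... | _ , _ , _ , nsp | _ , _ , first , inj₁ (p , q , _) = ⊥-elim (nsp (p , trans q (cong (a +_) (sym eq))))
  ... | _ , _ , _ , _ | _ , _ , first , inj₂ h' = h'
  ... | p , q , r , _ | c'' , o , later s , sg = ⊥-elim (<-irrefl refl (≤-trans (≤-trans (n≤1+n _) q)
        (≤-trans r (≤-trans (≤-reflexive (cong (a +_) eq)) (≤-trans (proj₁ (slot-bounds s)) (proj₁ (genSpan-bounds (slot-noUnary (proj₂ v') s) sg)))))))

  restChildren-sub : ∀ a c cs c' cs' → NoUnaryF (c ∷ cs) → NoUnaryF (c' ∷ cs') → leaves c' ≡ leaves c →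
    Sub₂ (GenForest (c ∷ cs) a) (GenForest (c' ∷ cs') a) → Sub₂ (GenForest cs (a + leaves c)) (GenForest cs' (a + leaves c'))
  restChildren-sub a c cs c' cs' v v' eq f i j (c'' , o , s , sg) with f i j (c'' , o , later s , sg)
  ... | _ , _ , later s' , sg' = _ , _ , s' , sg'
  ... | _ , _ , first , sg' = ⊥-elim (<-irrefl refl (≤-trans (proj₁ (proj₂ (genSpan-bounds (proj₁ v') sg')))
        (≤-trans (proj₂ (proj₂ (genSpan-bounds (proj₁ v') sg'))) (≤-trans (≤-reflexive (cong (a +_) eq))
        (≤-trans (proj₁ (slot-bounds s)) (proj₁ (genSpan-bounds (slot-noUnary (proj₂ v) s) sg)))))))

  mutual
    gen-injective : ∀ t t' a → NoUnary t → NoUnary t' → leaves t ≡ leaves t' →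
      Sub₂ (Gen t a) (Gen t' a) → Sub₂ (Gen t' a) (Gen t a) → t ≡ t'
    gen-injective (node []) t' a v v' e f g = sym (single-leaf t' v' (sym e))
    gen-injective (node (c ∷ cs)) (node []) a v v' e f g = single-leaf _ v e
    gen-injective (node (c ∷ cs)) (node (c' ∷ cs')) a v v' e f g =
      cong node (gen-injectiveF (c ∷ cs) (c' ∷ cs') a (proj₂ v) (proj₂ v') e
        (λ i j p → Gen→GenForest (f i j (GenForest→Gen p))) (λ i j p → Gen→GenForest (g i j (GenForest→Gen p))))

    gen-injectiveF : ∀ ts ts' a → NoUnaryF ts → NoUnaryF ts' → leavesF ts ≡ leavesF ts' →
      Sub₂ (GenForest ts a) (GenForest ts' a) → Sub₂ (GenForest ts' a) (GenForest ts a) → ts ≡ ts'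
    gen-injectiveF [] [] a v v' e f g = refl
    gen-injectiveF [] (c' ∷ cs') a v v' e f g = ⊥-elim (<-irrefl e (≤-trans (leaves≥1 c') (m≤m+n _ _)))
    gen-injectiveF (c ∷ cs) [] a v v' e f g = ⊥-elim (<-irrefl (sym e) (≤-trans (leaves≥1 c) (m≤m+n _ _)))
    gen-injectiveF (c ∷ cs) (c' ∷ cs') a v v' e f g =
      cong₂ _∷_ (ceq (leaves c ≟ 1)) (gen-injectiveF cs cs' (a + leaves c) (proj₂ v) (proj₂ v') (+-cancelˡ-≡ (leaves c) _ _ (trans e (cong (_+ leavesF cs') (sym eq))))
         (λ i j p → subst (λ z → GenForest cs' z i j) (cong (a +_) (sym eq)) (restChildren-sub a c cs c' cs' v v' (sym eq) f i j p))
         (λ i j p → restChildren-sub a c' cs' c cs v' v eq g i j (subst (λ z → GenForest cs' z i j) (cong (a +_) eq) p)))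
      where
      eq = firstChild-leaves a c cs c' cs' v v' f g
      ceq : Dec (leaves c ≡ 1) → c ≡ c'
      ceq (yes l1) = trans (single-leaf c (proj₁ v) l1) (sym (single-leaf c' (proj₁ v') (trans (sym eq) l1)))
      ceq (no _) = gen-injective c c' a (proj₁ v) (proj₁ v') eq (firstChild-sub a c cs c' cs' v v' eq f) (firstChild-sub a c' cs' c cs v' v (sym eq) g)

module Construction where
  open import Defs
  open LeafIntervals
  open Crossings
  open Injectivity
  open Search using (largest)
  open import Data.Nat
  open import Data.Nat.Properties
  open import Data.List using (List; []; _∷_; length)
  open import Data.Product using (Σ; _×_; _,_; proj₁; proj₂)
  open import Data.Sum using (_⊎_; inj₁; inj₂)
  open import Data.Empty
  open import Data.Unit using (tt)
  open import Relation.Binary.PropositionalEquality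
  open import Relation.Nullary
  open import Relation.Nullary.Decidable using (¬?)

  record NoncrossingSet (S : ℕ → ℕ → Set) : Set where
    field
      dec : ∀ i j → Dec (S i j)
      diag : ∀ {i j} → S i j → 2 + i ≤ j
      nc : ∀ {i j i' j'} → S i j → S i' j' → ¬ (i < i' × i' < j × j < j')

  without : (ℕ → ℕ → Set) → ℕ → ℕ → ℕ → ℕ → Set
  without S v b i j = S i j × ¬ (i ≡ v × j ≡ b)

  without-noncrossing : ∀ {S} v b → NoncrossingSet S → NoncrossingSet (without S v b)
  without-noncrossing {S} v b sp = record { dec = d ; diag = λ x → NoncrossingSet.diag sp (proj₁ x) ; nc = λ x y → NoncrossingSet.nc sp (proj₁ x) (proj₁ y) }
    where
    d : ∀ i j → Dec (without S v b i j)
    d i j = NoncrossingSet.dec sp i j ×-dec ¬? (i ≟ v ×-dec j ≟ b)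

  ForestFor : (ℕ → ℕ → Set) → ℕ → ℕ → Set
  ForestFor S v b = Σ (List Tree) λ ts → NoUnaryF ts × v + leavesF ts ≡ b ×
    (∀ i j → v ≤ i → j ≤ b → GenForest ts v i j → S i j) × (∀ i j → v ≤ i → j ≤ b → S i j → GenForest ts v i j)

  ChildFor : (ℕ → ℕ → Set) → ℕ → ℕ → Set
  ChildFor S v d = Σ Tree λ c → NoUnary c × v + leaves c ≡ d ×
    (∀ i j → v ≤ i → j ≤ d → GenSpan c v i j → S i j) × (∀ i j → v ≤ i → j ≤ d → S i j → GenSpan c v i j)

  genForest-bounds : ∀ {ts a i j} → NoUnaryF ts → GenForest ts a i j → a ≤ i × j ≤ a + leavesF ts
  genForest-bounds v (c , o , s , sg) with slot-bounds s | genSpan-bounds (slot-noUnary v s) sg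
  ... | p , q | p' , q' , r' = ≤-trans p p' , ≤-trans r' q

  leaves-node : ∀ ts → 1 ≤ leavesF ts → leaves (node ts) ≡ leavesF ts
  leaves-node (t ∷ ts) _ = refl

  -- a forest realising S without the chord {v, d} cannot consist of a single
  -- tree, whose span would be exactly that chord
  forest-notSingle : ∀ S v d ts → 2 + v ≤ d → v + leavesF ts ≡ d →
    (∀ i j → v ≤ i → j ≤ d → GenForest ts v i j → without S v d i j) → length ts ≢ 1
  forest-notSingle S v d (c ∷ []) two lts f1 e = proj₂ (f1 v (v + leaves c) ≤-refl (≤-reflexive lts')
        (c , v , first , inj₁ (refl , refl , +-cancelˡ-≤ v 2 _ (≤-trans (≤-trans (≤-reflexive (+-comm v 2)) two) (≤-reflexive (sym lts')))))) (refl , lts')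
    where
    lts' : v + leaves c ≡ d
    lts' = trans (cong (v +_) (sym (+-identityʳ _))) lts

  leafChild : ∀ S v → NoncrossingSet S → ChildFor S v (suc v)
  leafChild S v sp = node [] , ((λ ()) , tt) , +-comm v 1 ,
    (λ { i j lo hi (inj₁ (_ , _ , s≤s ())) ; i j lo hi (inj₂ (gen-inside () _)) ; i j lo hi (inj₂ (gen-span () _)) }) ,
    λ i j lo hi s → ⊥-elim (<-irrefl refl (≤-trans (≤-trans (NoncrossingSet.diag sp s) hi) (s≤s lo)))

  wrapForest : ∀ S v d → NoncrossingSet S → S v d → ForestFor (without S v d) v d → ChildFor S v d
  wrapForest S v d sp svd (ts , vts , lts , f1 , f2) =
    node ts , (forest-notSingle S v d ts two lts f1 , vts) , dL , g1 , g2
    where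
    two : 2 + v ≤ d
    two = NoncrossingSet.diag sp svd
    l1 : 1 ≤ leavesF ts
    l1 = +-cancelˡ-≤ v 1 _ (≤-trans (≤-trans (≤-reflexive (+-comm v 1)) (≤-trans (n≤1+n _) two)) (≤-reflexive (sym lts)))
    dL : v + leaves (node ts) ≡ d
    dL = trans (cong (v +_) (leaves-node ts l1)) lts
    g1 : ∀ i j → v ≤ i → j ≤ d → GenSpan (node ts) v i j → S i j
    g1 i j lo hi (inj₁ (refl , refl , _)) = subst (S v) (sym dL) svd
    g1 i j lo hi (inj₂ g) = proj₁ (f1 i j lo hi (Gen→GenForest g))
    g2 : ∀ i j → v ≤ i → j ≤ d → S i j → GenSpan (node ts) v i j
    g2 i j lo hi s with i ≟ v | j ≟ d
    ... | yes refl | yes refl = inj₁ (refl , sym dL , +-cancelˡ-≤ v 2 _ (≤-trans (≤-trans (≤-reflexive (+-comm v 2)) two) (≤-reflexive (sym dL))))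
    ... | no p | _ = inj₂ (GenForest→Gen (f2 i j lo hi (s , λ x → p (proj₁ x))))
    ... | yes _ | no q = inj₂ (GenForest→Gen (f2 i j lo hi (s , λ x → q (proj₂ x))))

  singleChild : ∀ {S v d} → ChildFor S v d → ForestFor S v d
  singleChild {S} {v} {d} (c , vc , lc , h1 , h2) =
    c ∷ [] , (vc , tt) , trans (cong (v +_) (+-identityʳ (leaves c))) lc , g1 , g2
    where
    g1 : ∀ i j → v ≤ i → j ≤ d → GenForest (c ∷ []) v i j → S i j
    g1 i j lo hi (_ , _ , first , sg) = h1 i j lo hi sg
    g1 i j lo hi (_ , _ , later () , _)
    g2 : ∀ i j → v ≤ i → j ≤ d → S i j → GenForest (c ∷ []) v i j
    g2 i j lo hi s = c , v , first , h2 i j lo hi s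

  Joined : (ℕ → ℕ → Set) → ℕ → ℕ → Set
  Joined S v w = w ≡ suc v ⊎ S v w

  Joined? : ∀ {S} → NoncrossingSet S → ∀ v w → Dec (Joined S v w)
  Joined? sp v w = w ≟ suc v ⊎-dec NoncrossingSet.dec sp v w

  -- If d is the farthest vertex below b joined to v, a tree for [v, d] followed
  -- by a forest for [d, b] realises S on [v, b]: by non-crossing, every chord of
  -- S inside [v, b] lies inside [v, d] or inside [d, b].
  consChild : ∀ {S v b d} → NoncrossingSet S → Joined S v d → (∀ w → d < w → w ≤ b → ¬ Joined S v w) →
    ChildFor S v d → ForestFor S d b → ForestFor S v b
  consChild {S} {v} {b} {d} sp pd mx (c , vc , lc , h1 , h2) (rs , vrs , lrs , r1 , r2) =
    c ∷ rs , (vc , vrs) , trans (sym (+-assoc v (leaves c) _)) (trans (cong (_+ leavesF rs) lc) lrs) , k1 , k2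
    where
    k1 : ∀ i j → v ≤ i → j ≤ b → GenForest (c ∷ rs) v i j → S i j
    k1 i j lo hi (_ , _ , first , sg) = h1 i j lo (≤-trans (proj₂ (proj₂ (genSpan-bounds vc sg))) (≤-reflexive lc)) sg
    k1 i j lo hi (c' , o , later s , sg) rewrite lc = r1 i j (proj₁ (genForest-bounds vrs (c' , o , s , sg))) hi (c' , o , s , sg)
    k2 : ∀ i j → v ≤ i → j ≤ b → S i j → GenForest (c ∷ rs) v i j
    k2 i j lo hi s with j ≤? d | d ≤? i
    ... | yes jd | _ = c , v , first , h2 i j lo jd s
    ... | no _ | yes di with r2 i j di hi s
    ... | (c' , o , s' , sg) rewrite sym lc = c' , o , later s' , sg
    k2 i j lo hi s | no jd | no di with m≤n⇒m<n∨m≡n lo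
    ... | inj₂ refl = ⊥-elim (mx j (≰⇒> jd) hi (inj₂ s))
    ... | inj₁ v<i = ⊥-elim (crossing pd)
      where
      crossing : Joined S v d → ⊥
      crossing (inj₁ refl) = di v<i
      crossing (inj₂ svd) = NoncrossingSet.nc sp svd s (v<i , ≰⇒> di , ≰⇒> jd)

  -- Let d be the farthest vertex
  -- joined to v.  If d < b, split [v, b] at d.  If d = b, the chord {v, b}
  -- becomes the single tree of the forest, and the recursion continues with the
  -- chord removed: then the farthest vertex joined to v is strictly below b.
  mutual
    forestFor : ∀ f S → NoncrossingSet S → ∀ v b → v < b → b ≤ v + f → ForestFor S v b
    forestFor zero S sp v b v<b bf = ⊥-elim (<-irrefl refl (<-≤-trans v<b (≤-trans bf (≤-reflexive (+-identityʳ v)))))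
    forestFor (suc f) S sp v b v<b bf with largest (Joined S v) (Joined? sp v) v b v<b (inj₁ refl)
    ... | d , vd , db , pd , mx with m≤n⇒m<n∨m≡n db
    ... | inj₁ d<b = forestFor-split f S sp v b bf d vd d<b pd mx
    ... | inj₂ refl with pd
    ... | inj₁ refl = singleChild (leafChild S v sp)
    ... | inj₂ svb = singleChild (wrapForest S v d sp svb inner)
      where
      S' = without S v d
      sp' = without-noncrossing v d sp
      inner : ForestFor S' v d
      inner with largest (Joined S' v) (Joined? sp' v) v d v<b (inj₁ refl)
      ... | d' , vd' , db' , pd' , mx' with m≤n⇒m<n∨m≡n db'
      ... | inj₁ d'<d = forestFor-split f S' sp' v d bf d' vd' d'<d pd' mx'
      ... | inj₂ refl = ⊥-elim (notJoined pd')
        where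
        notJoined : ¬ Joined S' v d
        notJoined (inj₁ e) = <-irrefl (sym e) (NoncrossingSet.diag sp svb)
        notJoined (inj₂ x) = proj₂ x (refl , refl)

    forestFor-split : ∀ f S → NoncrossingSet S → ∀ v b → b ≤ v + suc f → ∀ d → v < d → d < b → Joined S v d →
      (∀ w → d < w → w ≤ b → ¬ Joined S v w) → ForestFor S v b
    forestFor-split f S sp v b bf d vd d<b pd mx =
      consChild sp pd mx (childAt pd) (forestFor f S sp d b d<b (≤-trans bf (≤-trans (≤-reflexive (+-suc v f)) (+-monoˡ-≤ f vd))))
      where
      childAt : Joined S v d → ChildFor S v d
      childAt (inj₁ refl) = leafChild S v sp
      childAt (inj₂ svd) = wrapForest S v d sp svd (forestFor f (without S v d) (without-noncrossing v d sp) v d vd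
        (+-cancelˡ-≤ 1 _ _ (≤-trans d<b (≤-trans bf (≤-reflexive (+-suc v f))))))

-- The boundary points of a forest ts at offset a: the vertices a, a + leaves c₁,
-- a + leaves c₁ + leaves c₂, …, where the children's intervals meet.  A vertex
-- with d children gives a region with these d + 1 boundary points as corners.
module BoundaryPoints where
  open import Defs
  open LeafIntervals
  open import Data.Nat
  open import Data.Nat.Properties
  open import Data.List using (List; []; _∷_; length)
  open import Data.List.Membership.Propositional using (_∈_)
  open import Data.List.Relation.Unary.Any using (here; there)
  open import Data.List.Relation.Unary.All as All using (All; []; _∷_)
  open import Data.List.Relation.Unary.AllPairs using (AllPairs; []; _∷_)
  open import Data.Product using (Σ; _×_; _,_; proj₁)
  open import Data.Sum using (_⊎_; inj₁; inj₂)
  open import Data.Empty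
  open import Relation.Binary.PropositionalEquality
  open import Relation.Nullary

  breakpoints : ℕ → List Tree → List ℕ
  breakpoints a [] = []
  breakpoints a (c ∷ cs) = (a + leaves c) ∷ breakpoints (a + leaves c) cs

  boundary : List Tree → ℕ → List ℕ
  boundary ts a = a ∷ breakpoints a ts

  length-boundary : ∀ ts a → length (boundary ts a) ≡ suc (length ts)
  length-boundary ts a = cong suc (length-breakpoints ts a)
    where
    length-breakpoints : ∀ ts a → length (breakpoints a ts) ≡ length ts
    length-breakpoints [] a = refl
    length-breakpoints (c ∷ cs) a = cong suc (length-breakpoints cs _)

  boundary-bounds : ∀ ts a z → z ∈ boundary ts a → a ≤ z × z ≤ a + leavesF ts
  boundary-bounds ts a z (here refl) = ≤-refl , m≤m+n _ _
  boundary-bounds (c ∷ cs) a z (there p) with boundary-bounds cs (a + leaves c) z p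
  ... | x , y = ≤-trans (m≤m+n _ _) x , ≤-trans y (≤-reflexive (+-assoc a _ _))

  boundary-start : ∀ ts a z → z ∈ boundary ts a → z < a + leavesF ts → Σ Tree λ c → Slot ts a c z
  boundary-start [] a z (here refl) lt = ⊥-elim (<-irrefl (sym (+-identityʳ a)) lt)
  boundary-start (c ∷ cs) a z (here refl) lt = c , first
  boundary-start (c ∷ cs) a z (there p) lt with boundary-start cs (a + leaves c) z p (≤-trans lt (≤-reflexive (sym (+-assoc a _ _))))
  ... | c' , s = c' , later s

  boundary-end : ∀ {ts a c o} → Slot ts a c o → o + leaves c ∈ boundary ts a
  boundary-end first = there (here refl)
  boundary-end (later s) = there (boundary-end s)

  boundary-startMember : ∀ {ts a c o} → Slot ts a c o → o ∈ boundary ts a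
  boundary-startMember first = here refl
  boundary-startMember (later s) = there (boundary-startMember s)

  boundary-last : ∀ ts a → a + leavesF ts ∈ boundary ts a
  boundary-last [] a = here (+-identityʳ a)
  boundary-last (c ∷ cs) a = there (subst (_∈ boundary cs (a + leaves c)) (+-assoc a _ _) (boundary-last cs (a + leaves c)))

  boundary-cover : ∀ ts a z → a ≤ z → z ≤ a + leavesF ts → z ∈ boundary ts a ⊎ Σ Tree λ c → Σ ℕ λ o → Slot ts a c o × o < z × z < o + leaves c
  boundary-cover [] a z lo hi = inj₁ (here (≤-antisym (≤-trans hi (≤-reflexive (+-identityʳ a))) lo))
  boundary-cover (c ∷ cs) a z lo hi with m≤n⇒m<n∨m≡n lo
  ... | inj₂ refl = inj₁ (here refl)
  ... | inj₁ a<z with z <? a + leaves c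
  ... | yes lt = inj₂ (c , a , first , a<z , lt)
  ... | no ge with boundary-cover cs (a + leaves c) z (≮⇒≥ ge) (≤-trans hi (≤-reflexive (sym (+-assoc a _ _))))
  ... | inj₁ m = inj₁ (there m)
  ... | inj₂ (c' , o , s , x , y) = inj₂ (c' , o , later s , x , y)

  boundary-notInside : ∀ {ts a c o} z → z ∈ boundary ts a → Slot ts a c o → ¬ (o < z × z < o + leaves c)
  boundary-notInside {c ∷ cs} {a} z (here refl) s (x , y) = <-irrefl refl (<-≤-trans x (proj₁ (slot-bounds s)))
  boundary-notInside {c ∷ cs} {a} z (there p) first (x , y) = <-irrefl refl (<-≤-trans y (proj₁ (boundary-bounds cs _ z p)))
  boundary-notInside {c ∷ cs} {a} z (there p) (later s) (x , y) = boundary-notInside z p s (x , y)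

  boundary-sorted : ∀ ts a → AllPairs _<_ (boundary ts a)
  boundary-sorted [] a = [] ∷ []
  boundary-sorted (c ∷ cs) a = All.tabulate (λ {z} z∈ → <-≤-trans (m<m+n a (leaves≥1 c)) (proj₁ (boundary-bounds cs (a + leaves c) z z∈))) ∷ boundary-sorted cs (a + leaves c)

module Regions where
  open import Defs
  open LeafIntervals
  open Crossings
  open Injectivity
  open BoundaryPoints
  open import Data.Nat
  open import Data.Nat.Properties
  open import Data.List using (List; length)
  open import Data.List.Membership.Propositional using (_∈_)
  open import Data.List.Relation.Unary.Any using (here)
  open import Data.Product using (Σ; _×_; _,_; proj₁; proj₂)
  open import Data.Sum using (_⊎_; inj₁; inj₂)
  open import Data.Empty
  open import Relation.Binary.PropositionalEquality
  open import Relation.Nullary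
  open import Relation.Binary.Definitions using (tri<; tri≈; tri>)

  infix 2 _⇔'_
  _⇔'_ : Set → Set → Set
  A ⇔' B = (A → B) × (B → A)

  EdgeSpec : (ℕ → ℕ → Set) → List Tree → ℕ → Set
  EdgeSpec E ts a = ∀ i j → a ≤ i → i < j → j ≤ a + leavesF ts →
    E i j ⇔' ((i ≡ a × j ≡ a + leavesF ts) ⊎ j ≡ suc i ⊎ GenForest ts a i j)

  -- i < j are cyclically consecutive in the vertex set M (the ℕ-indexed form of
  -- `Consec`)
  ConsecutiveIn : (ℕ → Set) → ℕ → ℕ → Set
  ConsecutiveIn M i j = (∀ l → i < l → l < j → ¬ M l) ⊎ ((∀ l → l < i → ¬ M l) × (∀ l → j < l → ¬ M l))

  -- M spans a region of the edge relation E: two vertices of M are joined by an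
  -- edge iff they are cyclically consecutive in M (the ℕ-indexed form of `IsRegion`)
  RegionOf : (ℕ → ℕ → Set) → (ℕ → Set) → Set
  RegionOf E M = ∀ i j → M i → M j → i < j → E i j ⇔' ConsecutiveIn M i j

  Branching : List Tree → Set
  Branching ts = NoUnaryF ts × 2 ≤ length ts

  NotTwoPoints : (ℕ → Set) → Set
  NotTwoPoints M = ∀ x y → ¬ (∀ z → M z → z ≡ x ⊎ z ≡ y)

  branching-notFull : ∀ {ts a c o} → Branching ts → Slot ts a c o → ¬ (o ≡ a × o + leaves c ≡ a + leavesF ts)
  branching-notFull (v , l2) s (e1 , e2) with slot-full s e1 (+-cancelˡ-≡ _ _ _ (trans e2 (cong (_+ _) (sym e1))))
  ... | e = <-irrefl (sym e) l2

  slot-edge : ∀ {E ts a c o} → EdgeSpec E ts a → Slot ts a c o → E o (o + leaves c)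
  slot-edge {E} {ts} {a} {c} {o} ec s with slot-bounds s
  ... | lo , hi with leaves c ≟ 1
  ... | yes e1 = proj₂ (ec o (o + leaves c) lo (m<m+n o (leaves≥1 c)) hi) (inj₂ (inj₁ (trans (cong (o +_) e1) (+-comm o 1))))
  ... | no n1 = proj₂ (ec o (o + leaves c) lo (m<m+n o (leaves≥1 c)) hi) (inj₂ (inj₂ (c , o , s , inj₁ (refl , refl , ≤∧≢⇒< (leaves≥1 c) (λ x → n1 (sym x))))))

  genForest-slot : ∀ {ts a x y} → NoUnaryF ts → GenForest ts a x y → Σ Tree λ c → Σ ℕ λ o → Slot ts a c o × o ≤ x × y ≤ o + leaves c
  genForest-slot v (c , o , s , sg) with genSpan-bounds (slot-noUnary v s) sg
  ... | p , _ , r = c , o , s , p , r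

  -- the boundary points of a branching forest form a region: consecutive boundary
  -- points are joined by children's spans, and every other edge lies inside a child
  boundary-isRegion : ∀ {E ts a} → Branching ts → EdgeSpec E ts a → RegionOf E (_∈ boundary ts a)
  boundary-isRegion {E} {ts} {a} it ec i j mi mj i<j = to , from
    where
    bi = boundary-bounds ts a i mi
    bj = boundary-bounds ts a j mj
    to : E i j → ConsecutiveIn (_∈ boundary ts a) i j
    to e with proj₁ (ec i j (proj₁ bi) i<j (proj₂ bj)) e
    ... | inj₁ (refl , refl) = inj₂ ((λ l l<a m → <-irrefl refl (<-≤-trans l<a (proj₁ (boundary-bounds ts a l m)))) ,
                                     (λ l l> m → <-irrefl refl (<-≤-trans l> (proj₂ (boundary-bounds ts a l m)))))
    ... | inj₂ (inj₁ refl) = inj₁ λ l x y _ → <-irrefl refl (≤-trans y x)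
    ... | inj₂ (inj₂ g) with genForest-slot (proj₁ it) g
    ... | c , o , s , lo , hi = inj₁ λ l x y m → boundary-notInside l m s (≤-<-trans lo x , <-≤-trans y hi)
    from : ConsecutiveIn (_∈ boundary ts a) i j → E i j
    from (inj₂ (below , above)) = proj₂ (ec i j (proj₁ bi) i<j (proj₂ bj)) (inj₁ (ia , jb))
      where
      ia : i ≡ a
      ia = ≤-antisym (≮⇒≥ λ a<i → below a a<i (here refl)) (proj₁ bi)
      jb : j ≡ a + leavesF ts
      jb = ≤-antisym (proj₂ bj) (≮⇒≥ λ j< → above _ j< (boundary-last ts a))
    from (inj₁ nobetween) with boundary-start ts a i mi (<-≤-trans i<j (proj₂ bj))
    ... | c , s with <-cmp (i + leaves c) j
    ... | tri< lt _ _ = ⊥-elim (nobetween _ (m<m+n i (leaves≥1 c)) lt (boundary-end s))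
    ... | tri> _ _ gt = ⊥-elim (boundary-notInside j mj s (i<j , gt))
    ... | tri≈ _ refl _ = slot-edge ec s

module RegionRecovery where
  open import Defs
  open LeafIntervals
  open Crossings
  open Injectivity
  open BoundaryPoints
  open Regions
  open Search using (least; greatest; gap-neighbours)
  open import Data.Nat
  open import Data.Nat.Properties
  open import Data.List using (List; []; _∷_; length)
  open import Data.List.Membership.Propositional using (_∈_)
  open import Data.Product using (Σ; _×_; _,_; proj₁; proj₂)
  open import Data.Sum using (_⊎_; inj₁; inj₂)
  open import Data.Empty
  open import Relation.Binary.PropositionalEquality
  open import Relation.Nullary
  open import Relation.Binary.Definitions using (tri<; tri≈; tri>)

  -- A region M of E inside [a, a + L] that contains both end points contains
  -- every boundary point: a missing boundary point z would lie between two
  -- neighbours x < z < y of M, whose edge {x, y} is neither the spanning chord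
  -- (M would have only two points), nor a side, nor a chord generated inside a
  -- child (no boundary point is inside a child).
  region⊇boundary : ∀ {E ts a} {M : ℕ → Set} → Branching ts → EdgeSpec E ts a → (∀ z → Dec (M z)) →
    (∀ z → M z → a ≤ z × z ≤ a + leavesF ts) → RegionOf E M → NotTwoPoints M → M a → M (a + leavesF ts) →
    ∀ z → z ∈ boundary ts a → M z
  region⊇boundary {E} {ts} {a} {M} it ec M? bnd reg big ma mb z zp with M? z
  ... | yes mz = mz
  ... | no nz = ⊥-elim (noEdge (gap-neighbours M? ma mb a<z z<b nz))
    where
    L = leavesF ts
    bz = boundary-bounds ts a z zp
    a<z : a < z
    a<z = ≤∧≢⇒< (proj₁ bz) λ e → nz (subst M e ma)
    z<b : z < a + L
    z<b = ≤∧≢⇒< (proj₂ bz) λ e → nz (subst M (sym e) mb)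
    noEdge : (Σ ℕ λ x → Σ ℕ λ y → M x × M y × x < z × z < y × (∀ l → x < l → l < y → ¬ M l) ×
      (∀ w → M w → w < z → w ≤ x) × (∀ w → M w → z < w → y ≤ w)) → ⊥
    noEdge (x , y , Mx , My , x<z , z<y , between , lower , upper) =
      kinds (proj₁ (ec x y (proj₁ (bnd x Mx)) x<y (proj₂ (bnd y My))) (proj₂ (reg x y Mx My x<y) (inj₁ between)))
      where
      x<y = <-trans x<z z<y
      kinds : ((x ≡ a × y ≡ a + L) ⊎ y ≡ suc x ⊎ GenForest ts a x y) → ⊥
      kinds (inj₁ (refl , refl)) = big a (a + L) only
        where
        only : ∀ w → M w → w ≡ a ⊎ w ≡ a + L
        only w mw with <-cmp w z
        ... | tri< lt _ _ = inj₁ (≤-antisym (lower w mw lt) (proj₁ (bnd w mw)))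
        ... | tri≈ _ refl _ = ⊥-elim (nz mw)
        ... | tri> _ _ gt = inj₂ (≤-antisym (proj₂ (bnd w mw)) (upper w mw gt))
      kinds (inj₂ (inj₁ refl)) = <-irrefl refl (≤-trans z<y x<z)
      kinds (inj₂ (inj₂ g)) with genForest-slot (proj₁ it) g
      ... | c , o , s , lo , hi = boundary-notInside z zp s (≤-<-trans lo x<z , <-≤-trans z<y hi)

  -- Conversely such a region contains only boundary points: a point strictly
  -- inside a child would separate the two ends of that child's span, which are
  -- joined by an edge, so that span would have to be the spanning chord.
  region⊆boundary : ∀ {E ts a} {M : ℕ → Set} → Branching ts → EdgeSpec E ts a →
    (∀ z → M z → a ≤ z × z ≤ a + leavesF ts) → RegionOf E M → M a → M (a + leavesF ts) →
    (∀ z → z ∈ boundary ts a → M z) → ∀ z → M z → z ∈ boundary ts a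
  region⊆boundary {E} {ts} {a} {M} it ec bnd reg ma mb back z mz
    with boundary-cover ts a z (proj₁ (bnd z mz)) (proj₂ (bnd z mz))
  ... | inj₁ p = p
  ... | inj₂ (c , o , s , oz , zo)
    with proj₁ (reg o (o + leaves c) (back o (boundary-startMember s)) (back (o + leaves c) (boundary-end s))
                    (m<m+n o (leaves≥1 c))) (slot-edge ec s)
  ... | inj₁ nb = ⊥-elim (nb z oz zo mz)
  ... | inj₂ (below , above) = ⊥-elim (branching-notFull it s (oa , ob))
    where
    oa : o ≡ a
    oa = ≤-antisym (≮⇒≥ λ a<o → below a a<o ma) (proj₁ (slot-bounds s))
    ob : o + leaves c ≡ a + leavesF ts
    ob = ≤-antisym (proj₂ (slot-bounds s)) (≮⇒≥ λ lt → above _ lt mb)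

  region-at-forest : ∀ {E ts a} {M : ℕ → Set} → Branching ts → EdgeSpec E ts a → (∀ z → Dec (M z)) →
    (∀ z → M z → a ≤ z × z ≤ a + leavesF ts) → RegionOf E M → NotTwoPoints M → M a → M (a + leavesF ts) →
    ∀ z → M z ⇔' z ∈ boundary ts a
  region-at-forest it ec M? bnd reg big ma mb z =
    region⊆boundary it ec bnd reg ma mb back z , back z
    where
    back = region⊇boundary it ec M? bnd reg big ma mb

  twoChildren-leaves : ∀ ts → 2 ≤ length ts → 2 ≤ leavesF ts
  twoChildren-leaves (c ∷ []) (s≤s ())
  twoChildren-leaves (c ∷ c' ∷ cs) _ = ≤-trans (+-mono-≤ (leaves≥1 c) (≤-trans (leaves≥1 c') (m≤m+n _ _))) ≤-refl

  branching-children : ∀ {c₁ cs₁} → NoUnary (node (c₁ ∷ cs₁)) → Branching (c₁ ∷ cs₁)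
  branching-children {c₁} {[]} (n1 , v) = ⊥-elim (n1 refl)
  branching-children {c₁} {_ ∷ _} (n1 , v) = v , s≤s (s≤s z≤n)

  branching-child : ∀ {ts a c₁ cs₁ o} → Branching ts → Slot ts a (node (c₁ ∷ cs₁)) o → Branching (c₁ ∷ cs₁)
  branching-child it s = branching-children (slot-noUnary (proj₁ it) s)

  edgeSpec-child : ∀ {E ts a c₁ cs₁ o} → Branching ts → EdgeSpec E ts a → Slot ts a (node (c₁ ∷ cs₁)) o → EdgeSpec E (c₁ ∷ cs₁) o
  edgeSpec-child {E} {ts} {a} {c₁} {cs₁} {o} it ec s i j oi i<j jb = to , from
    where
    cs = c₁ ∷ cs₁
    sb = slot-bounds s
    ai = ≤-trans (proj₁ sb) oi
    jL = ≤-trans jb (proj₂ sb)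
    to : E i j → (i ≡ o × j ≡ o + leavesF cs) ⊎ j ≡ suc i ⊎ GenForest cs o i j
    to e with proj₁ (ec i j ai i<j jL) e
    ... | inj₁ (refl , refl) = ⊥-elim (branching-notFull it s (≤-antisym oi (proj₁ sb) , ≤-antisym (proj₂ sb) jb))
    ... | inj₂ (inj₁ x) = inj₂ (inj₁ x)
    ... | inj₂ (inj₂ (c' , o' , s' , sg')) with slot-disjoint s s' | genSpan-bounds (slot-noUnary (proj₁ it) s') sg'
    ... | inj₁ (refl , refl) | _ = fromChild sg'
      where
      fromChild : GenSpan (node cs) o i j → (i ≡ o × j ≡ o + leavesF cs) ⊎ j ≡ suc i ⊎ GenForest cs o i j
      fromChild (inj₁ (p , q , _)) = inj₁ (p , q)
      fromChild (inj₂ g) = inj₂ (inj₂ (Gen→GenForest g))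
    ... | inj₂ (inj₁ le) | lo' , _ , _ = ⊥-elim (<-irrefl refl (<-≤-trans i<j (≤-trans jb (≤-trans le lo'))))
    ... | inj₂ (inj₂ le) | _ , _ , hi' = ⊥-elim (<-irrefl refl (<-≤-trans i<j (≤-trans hi' (≤-trans le oi))))
    from : (i ≡ o × j ≡ o + leavesF cs) ⊎ j ≡ suc i ⊎ GenForest cs o i j → E i j
    from (inj₁ (refl , refl)) = proj₂ (ec i j ai i<j jL) (inj₂ (inj₂ (node cs , o , s , inj₁ (refl , refl , twoChildren-leaves cs (proj₂ (branching-child it s))))))
    from (inj₂ (inj₁ x)) = proj₂ (ec i j ai i<j jL) (inj₂ (inj₁ x))
    from (inj₂ (inj₂ g)) = proj₂ (ec i j ai i<j jL) (inj₂ (inj₂ (node cs , o , s , inj₂ (GenForest→Gen g))))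

  data Descendant : List Tree → ℕ → List Tree → ℕ → Set where
    self : ∀ {ts a} → Descendant ts a ts a
    down : ∀ {ts a c₁ cs₁ o us o'} → Slot ts a (node (c₁ ∷ cs₁)) o → Descendant (c₁ ∷ cs₁) o us o' → Descendant ts a us o'

  RecoveredRegion : (ℕ → ℕ → Set) → (ℕ → Set) → List Tree → ℕ → Set
  RecoveredRegion E M ts a = Σ (List Tree) λ us → Σ ℕ λ o' → Descendant ts a us o' × Branching us × EdgeSpec E us o' × (∀ z → M z ⇔' z ∈ boundary us o')

  branching-child-smaller : ∀ {ts a c o} → Branching ts → Slot ts a c o → leaves c < leavesF ts
  branching-child-smaller {ts} {a} {c} {o} it sl = ≤∧≢⇒< ℓ≤L λ e → branching-notFull it sl (oa e , cong₂ _+_ (oa e) e)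
    where
    sb = slot-bounds sl
    ℓ≤L : leaves c ≤ leavesF ts
    ℓ≤L = +-cancelˡ-≤ a _ _ (≤-trans (+-monoˡ-≤ (leaves c) (proj₁ sb)) (proj₂ sb))
    oa : leaves c ≡ leavesF ts → o ≡ a
    oa e = ≤-antisym (+-cancelʳ-≤ (leavesF ts) o a (≤-trans (≤-reflexive (cong (o +_) (sym e))) (proj₂ sb))) (proj₁ sb)

  notTwoPoints-spread : ∀ {M} → NotTwoPoints M → ∀ x → ¬ (∀ z → M z → x ≤ z × z ≤ suc x)
  notTwoPoints-spread big x h = big x (suc x) λ z mz → twoValues z (h z mz)
    where
    twoValues : ∀ z → x ≤ z × z ≤ suc x → z ≡ x ⊎ z ≡ suc x
    twoValues z (p , q) with m≤n⇒m<n∨m≡n q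
    ... | inj₁ (s≤s le) = inj₁ (≤-antisym le p)
    ... | inj₂ e = inj₂ e

  -- Let s < s' be the least and greatest points of a region
  -- M lying in the interval of a branching forest; {s, s'} is an edge.  If it is
  -- the spanning chord, M is the boundary of this forest; it cannot be a side;
  -- if it is generated inside a child, M lies in that child's interval and we
  -- recurse into the child (on the number f of leaves).
  recover-region : ∀ f {E ts a} {M : ℕ → Set} → leavesF ts ≤ f → Branching ts → EdgeSpec E ts a → (∀ z → Dec (M z)) →
    (∀ z → M z → a ≤ z × z ≤ a + leavesF ts) → RegionOf E M → NotTwoPoints M → ∀ w → M w → RecoveredRegion E M ts a
  recover-region zero {ts = ts} lf it ec M? bnd reg big w mw = ⊥-elim (<-irrefl refl (≤-trans (twoChildren-leaves ts (proj₂ it)) (≤-trans lf z≤n)))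
  recover-region (suc f) {E} {ts} {a} {M} lf it ec M? bnd reg big w mw = result
    where
    L = leavesF ts
    mn = least M M? w mw
    mx = greatest M M? w (a + L) mw (λ z mz → proj₂ (bnd z mz))
    s = proj₁ mn
    s' = proj₁ mx
    Ms = proj₁ (proj₂ mn)
    Ms' = proj₁ (proj₂ mx)
    inside : ∀ z → M z → s ≤ z × z ≤ s'
    inside z mz = ≮⇒≥ (λ lt → proj₂ (proj₂ mn) z lt mz) , ≮⇒≥ (λ lt → proj₂ (proj₂ mx) z lt mz)
    s<s' : s < s'
    s<s' = ≰⇒> λ le → big s s λ z mz → inj₁ (≤-antisym (≤-trans (proj₂ (inside z mz)) le) (proj₁ (inside z mz)))
    Ess' : E s s'
    Ess' = proj₂ (reg s s' Ms Ms' s<s') (inj₂ ((λ l lt ml → proj₂ (proj₂ mn) l lt ml) , (λ l lt ml → proj₂ (proj₂ mx) l lt ml)))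
    result : RecoveredRegion E M ts a
    result with proj₁ (ec s s' (proj₁ (bnd s Ms)) s<s' (proj₂ (bnd s' Ms'))) Ess'
    ... | inj₁ (es , es') = ts , a , self , it , ec , region-at-forest it ec M? bnd reg big (subst M es Ms) (subst M es' Ms')
    ... | inj₂ (inj₁ e) = ⊥-elim (notTwoPoints-spread big s λ z mz → proj₁ (inside z mz) , subst (z ≤_) e (proj₂ (inside z mz)))
    ... | inj₂ (inj₂ g) with genForest-slot (proj₁ it) g
    ... | node [] , o , sl , lo , hi = ⊥-elim (notTwoPoints-spread big o λ z mz →
            ≤-trans lo (proj₁ (inside z mz)) , ≤-trans (proj₂ (inside z mz)) (≤-trans hi (≤-reflexive (+-comm o 1))))
    ... | node (c₁ ∷ cs₁) , o , sl , lo , hi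
      with recover-region f {E} {c₁ ∷ cs₁} {o} {M} (s≤s⁻¹ (≤-trans (branching-child-smaller it sl) lf))
             (branching-child it sl) (edgeSpec-child it ec sl) M?
             (λ z mz → ≤-trans lo (proj₁ (inside z mz)) , ≤-trans (proj₂ (inside z mz)) hi) reg big w mw
    ... | us , o' , sub , r = us , o' , down sl sub , r

module RegionLists where
  open import Defs
  open LeafIntervals
  open BoundaryPoints
  open Regions
  open RegionRecovery
  open import Data.Nat
  open import Data.Nat.Properties
  open import Data.List using (List; []; _∷_; length; _++_)
  open import Data.List.Properties using (length-++; ∷-injectiveˡ)
  open import Data.List.Membership.Propositional using (_∈_)
  open import Data.List.Membership.Propositional.Properties
  open import Data.List.Relation.Unary.Any using (here)
  open import Data.List.Relation.Unary.All using ([]; _∷_)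
  open import Data.List.Relation.Unary.Unique.Propositional using (Unique; []; _∷_)
  import Data.List.Relation.Unary.Unique.Propositional.Properties as UP
  open import Data.Product using (Σ; _×_; _,_; proj₁; proj₂)
  open import Data.Sum using (inj₁; inj₂)
  open import Data.Empty
  open import Data.Bool using (if_then_else_)
  open import Relation.Binary.PropositionalEquality
  open import Relation.Nullary

  ownRegion : ∀ {d ts} → Dec (length ts ≡ d) → ℕ → List (List ℕ)
  ownRegion {ts = ts} (yes _) a = boundary ts a ∷ []
  ownRegion (no _) a = []

  mutual
    regionsT : ℕ → Tree → ℕ → List (List ℕ)
    regionsT d (node []) a = []
    regionsT d (node (c ∷ cs)) a = regionsF d (c ∷ cs) a

    regionsF : ℕ → List Tree → ℕ → List (List ℕ)
    regionsF d ts a = ownRegion {d} {ts} (length ts ≟ d) a ++ regionsC d ts a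

    regionsC : ℕ → List Tree → ℕ → List (List ℕ)
    regionsC d [] a = []
    regionsC d (c ∷ cs) a = regionsT d c a ++ regionsC d cs (a + leaves c)

  ownRegion-length : ∀ {d ts} (p : Dec (length ts ≡ d)) a → length (ownRegion {d} {ts} p a) ≡ (if does p then 1 else 0)
  ownRegion-length (yes _) a = refl
  ownRegion-length (no _) a = refl

  mutual
    regionsT-length : ∀ d → 1 ≤ d → ∀ t a → length (regionsT d t a) ≡ degCount d t
    regionsT-length (suc d) _ (node []) a = refl
    regionsT-length d d1 (node (c ∷ cs)) a = trans (length-++ (ownRegion {d} {c ∷ cs} (length (c ∷ cs) ≟ d) a) {regionsC d (c ∷ cs) a})
      (cong₂ _+_ (ownRegion-length {d} {c ∷ cs} (length (c ∷ cs) ≟ d) a) (regionsC-length d d1 (c ∷ cs) a))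

    regionsC-length : ∀ d → 1 ≤ d → ∀ ts a → length (regionsC d ts a) ≡ degCountF d ts
    regionsC-length d d1 [] a = refl
    regionsC-length d d1 (c ∷ cs) a = trans (length-++ (regionsT d c a) {regionsC d cs (a + leaves c)}) (cong₂ _+_ (regionsT-length d d1 c a) (regionsC-length d d1 cs _))

  descendant-bounds : ∀ {ts a us o'} → Descendant ts a us o' → a ≤ o' × o' + leavesF us ≤ a + leavesF ts
  descendant-bounds self = ≤-refl , ≤-refl
  descendant-bounds (down s sub) with slot-bounds s | descendant-bounds sub
  ... | p , q | p' , q' = ≤-trans p p' , ≤-trans q' q

  descendant-branching : ∀ {ts a us o'} → Branching ts → Descendant ts a us o' → Branching us
  descendant-branching it self = it
  descendant-branching it (down s sub) = descendant-branching (branching-child it s) sub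

  descendant-edgeSpec : ∀ {E ts a us o'} → Branching ts → EdgeSpec E ts a → Descendant ts a us o' → EdgeSpec E us o'
  descendant-edgeSpec it ec self = ec
  descendant-edgeSpec it ec (down s sub) = descendant-edgeSpec (branching-child it s) (edgeSpec-child it ec s) sub

  DescendantRegion : ℕ → List Tree → ℕ → List ℕ → Set
  DescendantRegion d ts a p = Σ (List Tree) λ us → Σ ℕ λ o' → Descendant ts a us o' × p ≡ boundary us o' × length us ≡ d

  ChildRegion : ℕ → List Tree → ℕ → List ℕ → Set
  ChildRegion d ts a p = Σ Tree λ c₁ → Σ (List Tree) λ cs₁ → Σ ℕ λ o → Slot ts a (node (c₁ ∷ cs₁)) o × DescendantRegion d (c₁ ∷ cs₁) o p

  mutual
    regionsF-member : ∀ d ts a p → p ∈ regionsF d ts a → DescendantRegion d ts a p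
    regionsF-member d ts a p m with length ts ≟ d
    regionsF-member d ts a p m | yes e with ∈-++⁻ (boundary ts a ∷ []) m
    ... | inj₁ (here refl) = ts , a , self , refl , e
    ... | inj₂ m' with regionsC-member d ts a p m'
    ... | c₁ , cs₁ , o , s , us , o' , sub , r = us , o' , down s sub , r
    regionsF-member d ts a p m | no _ with regionsC-member d ts a p m
    ... | c₁ , cs₁ , o , s , us , o' , sub , r = us , o' , down s sub , r

    regionsC-member : ∀ d ts a p → p ∈ regionsC d ts a → ChildRegion d ts a p
    regionsC-member d (c ∷ cs) a p m with ∈-++⁻ (regionsT d c a) m
    regionsC-member d (node [] ∷ cs) a p m | inj₁ ()
    regionsC-member d (node (c₁ ∷ cs₁) ∷ cs) a p m | inj₁ m' = c₁ , cs₁ , a , first , regionsF-member d (c₁ ∷ cs₁) a p m'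
    ... | inj₂ m' with regionsC-member d cs (a + leaves c) p m'
    ... | c₁ , cs₁ , o , s , r = c₁ , cs₁ , o , later s , r

  slot-regions : ∀ d {ts a c₁ cs₁ o p} → Slot ts a (node (c₁ ∷ cs₁)) o → p ∈ regionsF d (c₁ ∷ cs₁) o → p ∈ regionsC d ts a
  slot-regions d first m = ∈-++⁺ˡ m
  slot-regions d {c ∷ cs} (later s) m = ∈-++⁺ʳ (regionsT d c _) (slot-regions d s m)

  descendant-region : ∀ d {ts a us o'} → Descendant ts a us o' → length us ≡ d → boundary us o' ∈ regionsF d ts a
  descendant-region d {ts} {a} self e with length ts ≟ d
  ... | yes _ = here refl
  ... | no ne = ⊥-elim (ne e)
  descendant-region d {ts} {a} (down s sub) e = ∈-++⁺ʳ (ownRegion {d} {ts} (length ts ≟ d) a) (slot-regions d s (descendant-region d sub e))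

  branching-leaves : ∀ {us} → Branching us → 1 ≤ leavesF us
  branching-leaves {us} it = ≤-trans (s≤s z≤n) (twoChildren-leaves us (proj₂ it))

  boundary-head : ∀ {us o us' o'} → boundary us o ≡ boundary us' o' → o ≡ o'
  boundary-head = ∷-injectiveˡ

  -- no region is listed twice: distinct descendants have distinct start points
  -- or, sharing the start point, different end points
  mutual
    regionsF-unique : ∀ d ts a → Branching ts → Unique (regionsF d ts a)
    regionsF-unique d ts a it = UP.++⁺ (own-unique (length ts ≟ d)) (regionsC-unique d ts a (proj₁ it)) own∉children
      where
      own-unique : (p : Dec (length ts ≡ d)) → Unique (ownRegion {d} {ts} p a)
      own-unique (yes _) = [] ∷ []
      own-unique (no _) = []
      -- a region of a proper descendant would need a child covering everything
      own∉children : ∀ {v} → ¬ (v ∈ ownRegion {d} {ts} (length ts ≟ d) a × v ∈ regionsC d ts a)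
      own∉children {v} (m1 , m2) with length ts ≟ d | m1
      ... | yes _ | here refl with regionsC-member d ts a v m2
      ... | c₁ , cs₁ , o , s , us , o' , sub , e , _ = branching-notFull it s (oa , ob)
        where
        sb = slot-bounds s
        ub = descendant-bounds sub
        ao : a ≡ o'
        ao = boundary-head e
        oa : o ≡ a
        oa = ≤-antisym (≤-trans (proj₁ ub) (≤-reflexive (sym ao))) (proj₁ sb)
        lastm : a + leavesF ts ∈ boundary us o'
        lastm = subst (a + leavesF ts ∈_) e (boundary-last ts a)
        ob : o + leaves (node (c₁ ∷ cs₁)) ≡ a + leavesF ts
        ob = ≤-antisym (proj₂ sb) (≤-trans (proj₂ (boundary-bounds us o' _ lastm)) (proj₂ ub))
      own∉children {v} (m1 , m2) | no _ | ()

    regionsC-unique : ∀ d ts a → NoUnaryF ts → Unique (regionsC d ts a)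
    regionsC-unique d [] a v = []
    regionsC-unique d (c ∷ cs) a (vc , vcs) =
      UP.++⁺ (regionsT-unique d c a vc) (regionsC-unique d cs (a + leaves c) vcs) (apart c vc)
      where
      -- regions inside the first child start before its end, those of the
      -- later children start after it
      apart : ∀ c → NoUnary c → ∀ {p} → ¬ (p ∈ regionsT d c a × p ∈ regionsC d cs (a + leaves c))
      apart (node []) _ (() , _)
      apart (node (c₁ ∷ cs₁)) vc {p} (m1 , m2) with regionsF-member d (c₁ ∷ cs₁) a p m1 | regionsC-member d cs (a + leaves (node (c₁ ∷ cs₁))) p m2
      ... | us , o' , sub , e , _ | c₁' , cs₁' , o , s , us' , o'' , sub' , e' , _ =
        <-irrefl refl (≤-trans (≤-reflexive (+-comm 1 o')) (≤-trans endsBefore (≤-trans startsAfter (≤-reflexive sameStart))))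
        where
        startsAfter = ≤-trans (proj₁ (slot-bounds s)) (proj₁ (descendant-bounds sub'))
        sameStart = boundary-head (trans (sym e') e)
        endsBefore = ≤-trans (+-monoʳ-≤ o' (branching-leaves (descendant-branching (branching-children vc) sub))) (proj₂ (descendant-bounds sub))

    regionsT-unique : ∀ d t a → NoUnary t → Unique (regionsT d t a)
    regionsT-unique d (node []) a v = []
    regionsT-unique d (node (c₁ ∷ cs₁)) a v = regionsF-unique d (c₁ ∷ cs₁) a (branching-children v)

-- Counting the true bits of a Boolean vector, needed to compute the number of
-- corners of a region given as a subset of the polygon's vertices.
module BitCounting where
  open import Data.Nat
  open import Data.Nat.Properties
  open import Data.Fin as F using (toℕ)
  open import Data.Fin.Subset using (_∈_; ∣_∣)
  open import Data.Vec using (Vec; lookup; []; _∷_)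
  open import Data.List as L using (List; length)
  open import Data.List.Properties using (length-++-sucʳ)
  open import Data.List.Membership.DecPropositional _≟_ using () renaming (_∈?_ to _∈ℕ?_)
  import Data.List.Membership.Propositional as LM
  open import Data.List.Membership.Propositional.Properties using (∈-∃++; ∈-++⁻; ∈-++⁺ˡ; ∈-++⁺ʳ)
  open import Data.List.Relation.Unary.Any using (here; there)
  open import Data.List.Relation.Unary.All as All using (All)
  open import Data.List.Relation.Unary.AllPairs using (AllPairs; []; _∷_)
  open import Data.Product using (_×_; _,_; proj₁; proj₂)
  open import Data.Sum using (inj₁; inj₂)
  open import Data.Empty
  open import Data.Bool using (Bool; true; false; if_then_else_)
  open import Relation.Binary.PropositionalEquality
  open import Relation.Nullary
  open import Function using (id)

  countTrue : (ℕ → Bool) → ℕ → ℕ → ℕ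
  countTrue g k zero = 0
  countTrue g k (suc m) = (if g k then suc else id) (countTrue g (suc k) m)

  size-countTrue : ∀ {m} (g : ℕ → Bool) k (v : Vec Bool m) → (∀ x → lookup v x ≡ g (k + toℕ x)) → ∣ v ∣ ≡ countTrue g k m
  size-countTrue g k [] h = refl
  size-countTrue g k (b ∷ v) h with trans (h F.zero) (cong g (+-identityʳ k))
  ... | e with size-countTrue g (suc k) v (λ x → trans (h (F.suc x)) (cong g (+-suc k (toℕ x))))
  ... | ih with b | g k
  ... | true | true = cong suc ih
  ... | false | false = ih
  size-countTrue g k (b ∷ v) h | () | ih | true | false
  size-countTrue g k (b ∷ v) h | () | ih | false | true

  countTrue-cong : ∀ g g' k m → (∀ z → k ≤ z → g z ≡ g' z) → countTrue g k m ≡ countTrue g' k m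
  countTrue-cong g g' k zero h = refl
  countTrue-cong g g' k (suc m) h with countTrue-cong g g' (suc k) m (λ z le → h z (≤-trans (n≤1+n k) le)) | h k ≤-refl
  ... | ih | e with g k | g' k
  ... | true | true = cong suc ih
  ... | false | false = ih
  countTrue-cong g g' k (suc m) h | ih | () | true | false
  countTrue-cong g g' k (suc m) h | ih | () | false | true

  countTrue-true : ∀ g k m → g k ≡ true → countTrue g k (suc m) ≡ suc (countTrue g (suc k) m)
  countTrue-true g k m e rewrite e = refl

  countTrue-false : ∀ g k m → g k ≡ false → countTrue g k (suc m) ≡ countTrue g (suc k) m
  countTrue-false g k m e rewrite e = refl

  memberB : List ℕ → ℕ → Bool
  memberB p z = does (z ∈ℕ? p)

  memberB-true : ∀ z p → z LM.∈ p → does (z ∈ℕ? p) ≡ true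
  memberB-true z p q with z ∈ℕ? p
  ... | yes _ = refl
  ... | no n = ⊥-elim (n q)

  memberB-false : ∀ z p → ¬ (z LM.∈ p) → does (z ∈ℕ? p) ≡ false
  memberB-false z p q with z ∈ℕ? p
  ... | yes r = ⊥-elim (q r)
  ... | no n = refl

  countTrue-sorted : ∀ m k (p : List ℕ) → AllPairs _<_ p → (∀ z → z LM.∈ p → k ≤ z × z < k + m) → countTrue (memberB p) k m ≡ length p
  countTrue-sorted zero k L.[] sp bd = refl
  countTrue-sorted zero k (x L.∷ p) sp bd = ⊥-elim (<-irrefl refl (<-≤-trans (proj₂ (bd x (here refl))) (≤-trans (≤-reflexive (+-identityʳ k)) (proj₁ (bd x (here refl))))))
  countTrue-sorted (suc m) k L.[] sp bd = countTrue-sorted m (suc k) L.[] sp (λ z ())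
  countTrue-sorted (suc m) k (x L.∷ p) (hx ∷ sp) bd with x ≟ k
  ... | yes refl = trans (countTrue-true (memberB (k L.∷ p)) k m (memberB-true k (k L.∷ p) (here refl))) (cong suc (trans (countTrue-cong (memberB (k L.∷ p)) (memberB p) (suc k) m agree)
                  (countTrue-sorted m (suc k) p sp λ z z∈ → All.lookup hx z∈ , ≤-trans (proj₂ (bd z (there z∈))) (≤-reflexive (+-suc k m)))))
    where
    agree : ∀ z → suc k ≤ z → memberB (k L.∷ p) z ≡ memberB p z
    agree z le = byDecision (z ∈ℕ? p)
      where
      byDecision : Dec (z LM.∈ p) → memberB (k L.∷ p) z ≡ memberB p z
      byDecision (yes q) = trans (memberB-true z (k L.∷ p) (there q)) (sym (memberB-true z p q))
      byDecision (no nq) = trans (memberB-false z (k L.∷ p) λ { (here refl) → <-irrefl refl le ; (there r) → nq r }) (sym (memberB-false z p nq))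
  countTrue-sorted (suc m) k (x L.∷ p) (hx ∷ sp) bd | no x≢k = trans (countTrue-false (memberB (x L.∷ p)) k m (memberB-false k (x L.∷ p) nk)) (countTrue-sorted m (suc k) (x L.∷ p) (hx ∷ sp) λ z z∈ → lower z z∈ , ≤-trans (proj₂ (bd z z∈)) (≤-reflexive (+-suc k m)))
    where
    kx : k < x
    kx = ≤∧≢⇒< (proj₁ (bd x (here refl))) (λ e → x≢k (sym e))
    nk : ¬ (k LM.∈ (x L.∷ p))
    nk (here e) = x≢k (sym e)
    nk (there q) = <-irrefl refl (<-trans kx (All.lookup hx q))
    lower : ∀ z → z LM.∈ (x L.∷ p) → suc k ≤ z
    lower z (here refl) = kx
    lower z (there q) = <-trans kx (All.lookup hx q)

  countTrue-cover : ∀ g k m (p : List ℕ) → (∀ z → k ≤ z → g z ≡ true → z LM.∈ p) → countTrue g k m ≤ length p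
  countTrue-cover g k zero p h = z≤n
  countTrue-cover g k (suc m) p h with g k in eq
  ... | false = countTrue-cover g (suc k) m p (λ z le gz → h z (≤-trans (n≤1+n k) le) gz)
  ... | true with ∈-∃++ (h k ≤-refl eq)
  ... | as , bs , refl = ≤-trans (s≤s (countTrue-cover g (suc k) m (as L.++ bs) h')) (≤-reflexive (sym (length-++-sucʳ as k bs)))
    where
    h' : ∀ z → suc k ≤ z → g z ≡ true → z LM.∈ (as L.++ bs)
    h' z le gz with ∈-++⁻ as (h z (≤-trans (n≤1+n k) le) gz)
    ... | inj₁ q = ∈-++⁺ˡ q
    ... | inj₂ (here refl) = ⊥-elim (<-irrefl refl le)
    ... | inj₂ (there q) = ∈-++⁺ʳ as q

  sorted-unique : ∀ (p q : List ℕ) → AllPairs _<_ p → AllPairs _<_ q → (∀ z → z LM.∈ p → z LM.∈ q) → (∀ z → z LM.∈ q → z LM.∈ p) → p ≡ q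
  sorted-unique L.[] L.[] _ _ f g = refl
  sorted-unique L.[] (y L.∷ q) _ _ f g with g y (here refl)
  ... | ()
  sorted-unique (x L.∷ p) L.[] _ _ f g with f x (here refl)
  ... | ()
  sorted-unique (x L.∷ p) (y L.∷ q) (hx ∷ sp) (hy ∷ sq) f g = cong₂ L._∷_ xy (sorted-unique p q sp sq f' g')
    where
    ge : ∀ {x y p} → All (y <_) p → x LM.∈ (y L.∷ p) → y ≤ x
    ge h (here refl) = ≤-refl
    ge h (there q) = <⇒≤ (All.lookup h q)
    xy : x ≡ y
    xy = ≤-antisym (ge hx (g y (here refl))) (ge hy (f x (here refl)))
    f' : ∀ z → z LM.∈ p → z LM.∈ q
    f' z z∈ with f z (there z∈)
    ... | here refl = ⊥-elim (<-irrefl xy (All.lookup hx z∈))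
    ... | there r = r
    g' : ∀ z → z LM.∈ q → z LM.∈ p
    g' z z∈ with g z (there z∈)
    ... | here refl = ⊥-elim (<-irrefl (sym xy) (All.lookup hy z∈))
    ... | there r = r

module Encoding where
  open import Defs
  open LeafIntervals
  open Crossings
  open Regions
  open BitCounting
  open import Data.Nat
  open import Data.Nat.Properties
  open import Data.Fin using (Fin; toℕ; fromℕ<)
  open import Data.Fin.Properties using (toℕ<n; fromℕ<-toℕ; toℕ-fromℕ<)
  open import Data.Fin.Subset using (Subset; _∈_; ∣_∣)
  import Data.Fin.Subset.Properties as SubP
  open import Data.Vec using (lookup; tabulate)
  import Data.Vec.Properties as VP
  open import Data.List as L using (List; length)
  import Data.List.Membership.Propositional as LM
  open import Data.List.Relation.Unary.Any using (here; there)
  open import Data.List.Relation.Unary.AllPairs using (AllPairs)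
  open import Data.Product using (Σ; _×_; _,_; proj₁; proj₂)
  open import Data.Sum using (_⊎_; inj₁; inj₂; map₂)
  open import Data.Empty
  open import Data.Bool using (Bool; true; false)
  open import Relation.Binary.PropositionalEquality
  open import Relation.Nullary
  open import Data.List.Membership.DecPropositional _≟_ using () renaming (_∈?_ to _∈ℕ?_)

  dec-true : ∀ {P : Set} (d : Dec P) → does d ≡ true ⇔' P
  dec-true (yes p) = (λ _ → p) , (λ _ → refl)
  dec-true (no np) = (λ ()) , (λ p → ⊥-elim (np p))

  dissectionOf : ∀ {n} → Tree → Diagonals n
  dissectionOf t = tabulate λ i → tabulate λ j → does (decGen t 0 (toℕ i) (toℕ j))

  has-dissectionOf : ∀ {n} t (i j : Fin (suc (suc n))) → Has (dissectionOf {n} t) i j ⇔' Gen t 0 (toℕ i) (toℕ j)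
  has-dissectionOf {n} t i j = (λ h → proj₁ (dec-true (decGen t 0 (toℕ i) (toℕ j))) (trans (sym e) h)) ,
                     (λ x → trans e (proj₂ (dec-true (decGen t 0 (toℕ i) (toℕ j))) x))
    where
    e : lookup (lookup (dissectionOf {n} t) i) j ≡ does (decGen t 0 (toℕ i) (toℕ j))
    e = trans (cong (λ r → lookup r j) (VP.lookup∘tabulate (λ i → tabulate λ j → does (decGen t 0 (toℕ i) (toℕ j))) i))
              (VP.lookup∘tabulate (λ j → does (decGen t 0 (toℕ i) (toℕ j))) j)

  EncodedEdge : ℕ → List Tree → ℕ → ℕ → Set
  EncodedEdge n ts x y = (y ≡ suc x) ⊎ (x ≡ 0 × y ≡ suc n) ⊎ Gen (node ts) 0 x y

  edge-dissectionOf : ∀ {n} ts (i j : Fin (suc (suc n))) → Edge (dissectionOf {n} (node ts)) i j ⇔' EncodedEdge n ts (toℕ i) (toℕ j)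
  edge-dissectionOf ts i j =
    map₂ (map₂ (proj₁ (has-dissectionOf (node ts) i j))) , map₂ (map₂ (proj₂ (has-dissectionOf (node ts) i j)))

  -- for a tree with n + 1 leaves, the encoded edges are specified by its children
  -- (the spanning chord {0, n + 1} is the side of the polygon closing it)
  edgeSpec-root : ∀ n ts → leavesF ts ≡ suc n → EdgeSpec (EncodedEdge n ts) ts 0
  edgeSpec-root n ts e i j _ _ _ = f , g
    where
    Specified : Set
    Specified = (i ≡ 0 × j ≡ 0 + leavesF ts) ⊎ j ≡ suc i ⊎ GenForest ts 0 i j
    f : EncodedEdge n ts i j → Specified
    f (inj₁ x) = inj₂ (inj₁ x)
    f (inj₂ (inj₁ (p , q))) = inj₁ (p , trans q (sym e))
    f (inj₂ (inj₂ h)) = inj₂ (inj₂ (Gen→GenForest h))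
    g : Specified → EncodedEdge n ts i j
    g (inj₁ (p , q)) = inj₂ (inj₁ (p , trans q e))
    g (inj₂ (inj₁ x)) = inj₁ x
    g (inj₂ (inj₂ h)) = inj₂ (inj₂ (GenForest→Gen h))

  MemberOf : ∀ {n} → Subset (suc (suc n)) → ℕ → Set
  MemberOf {n} S z = Σ (z < suc (suc n)) λ p → fromℕ< p ∈ S

  MemberOf? : ∀ {n} (S : Subset (suc (suc n))) z → Dec (MemberOf S z)
  MemberOf? {n} S z with z <? suc (suc n)
  ... | no np = no λ x → np (proj₁ x)
  ... | yes p with fromℕ< p SubP.∈? S
  ... | yes q = yes (p , q)
  ... | no nq = no λ x → nq (subst (_∈ S) refl (proj₂ x))

  memberOf-fin : ∀ {n} (S : Subset (suc (suc n))) x → x ∈ S ⇔' MemberOf S (toℕ x)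
  memberOf-fin S x = (λ m → toℕ<n x , subst (_∈ S) (sym (fromℕ<-toℕ x (toℕ<n x))) m) ,
               (λ { (p , m) → subst (_∈ S) (fromℕ<-toℕ x p) m })

  memberOf-bound : ∀ {n} {S : Subset (suc (suc n))} {z} → MemberOf S z → z ≤ suc n
  memberOf-bound (p , _) = s≤s⁻¹ p

  consec-memberOf : ∀ {n} (S : Subset (suc (suc n))) (i j : Fin (suc (suc n))) → Consec S i j ⇔' ConsecutiveIn (MemberOf S) (toℕ i) (toℕ j)
  consec-memberOf {n} S i j = to , from
    where
    fin : ∀ z → MemberOf S z → Σ (Fin (suc (suc n))) λ l → toℕ l ≡ z × l ∈ S
    fin z (p , m) = fromℕ< p , toℕ-fromℕ< p , m
    to : Consec S i j → ConsecutiveIn (MemberOf S) (toℕ i) (toℕ j)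
    to (inj₁ h) = inj₁ λ l a b m → noneBetween l a b (fin l m)
      where
      noneBetween : ∀ l → toℕ i < l → l < toℕ j → (Σ (Fin (suc (suc n))) λ l' → toℕ l' ≡ l × l' ∈ S) → ⊥
      noneBetween l a b (l' , refl , m') = h l' a b m'
    to (inj₂ (h1 , h2)) = inj₂ ((λ l a m → c₁ (fin l m) a) , (λ l a m → noneAbove (fin l m) a))
      where
      c₁ : ∀ {l} → (Σ (Fin (suc (suc n))) λ l' → toℕ l' ≡ l × l' ∈ S) → l < toℕ i → ⊥
      c₁ (l' , refl , m') a = h1 l' a m'
      noneAbove : ∀ {l} → (Σ (Fin (suc (suc n))) λ l' → toℕ l' ≡ l × l' ∈ S) → toℕ j < l → ⊥
      noneAbove (l' , refl , m') a = h2 l' a m'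
    from : ConsecutiveIn (MemberOf S) (toℕ i) (toℕ j) → Consec S i j
    from (inj₁ h) = inj₁ λ l a b m → h (toℕ l) a b (proj₁ (memberOf-fin S l) m)
    from (inj₂ (h1 , h2)) = inj₂ ((λ l a m → h1 (toℕ l) a (proj₁ (memberOf-fin S l) m)) , (λ l a m → h2 (toℕ l) a (proj₁ (memberOf-fin S l) m)))

  toSub : ∀ {n} → List ℕ → Subset (suc (suc n))
  toSub p = tabulate λ x → memberB p (toℕ x)

  memberOf-toSub : ∀ {n} (p : List ℕ) → (∀ z → z LM.∈ p → z < suc (suc n)) → ∀ z → MemberOf {n} (toSub p) z ⇔' z LM.∈ p
  memberOf-toSub {n} p bd z = f , g
    where
    f : MemberOf (toSub p) z → z LM.∈ p
    f (q , m) = proj₁ (dec-true (z ∈ℕ? p)) (trans (sym (cong (memberB p) (toℕ-fromℕ< q))) (trans (sym (VP.lookup∘tabulate (λ x → memberB p (toℕ x)) (fromℕ< q))) (VP.[]=⇒lookup m)))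
    g : z LM.∈ p → MemberOf (toSub p) z
    g m = bd z m , VP.lookup⇒[]= (fromℕ< (bd z m)) (toSub p) (trans (VP.lookup∘tabulate (λ x → memberB p (toℕ x)) (fromℕ< (bd z m)))
            (trans (cong (memberB p) (toℕ-fromℕ< (bd z m))) (proj₂ (dec-true (z ∈ℕ? p)) m)))

  size-toSub : ∀ {n} (p : List ℕ) → AllPairs _<_ p → (∀ z → z LM.∈ p → z < suc (suc n)) → ∣ toSub {n} p ∣ ≡ length p
  size-toSub {n} p sp bd = trans (size-countTrue (memberB p) 0 (toSub {n} p) (λ x → VP.lookup∘tabulate (λ x → memberB p (toℕ x)) x))
    (countTrue-sorted (suc (suc n)) 0 p sp (λ z m → z≤n , bd z m))

  subsetBit : ∀ {n} → Subset (suc (suc n)) → ℕ → Bool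
  subsetBit {n} S z with z <? suc (suc n)
  ... | yes p = lookup S (fromℕ< p)
  ... | no _ = false

  subsetBit-lookup : ∀ {n} (S : Subset (suc (suc n))) x → lookup S x ≡ subsetBit S (toℕ x)
  subsetBit-lookup {n} S x with toℕ x <? suc (suc n)
  ... | yes p = cong (lookup S) (sym (fromℕ<-toℕ x p))
  ... | no np = ⊥-elim (np (toℕ<n x))

  subsetBit-member : ∀ {n} (S : Subset (suc (suc n))) z → subsetBit S z ≡ true → MemberOf S z
  subsetBit-member {n} S z with z <? suc (suc n)
  ... | yes p = λ e → p , VP.lookup⇒[]= (fromℕ< p) S e
  ... | no _ = λ ()

  three-notTwoPoints : ∀ {n} (S : Subset (suc (suc n))) → 3 ≤ ∣ S ∣ → NotTwoPoints (MemberOf S)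
  three-notTwoPoints {n} S le x y h = <-irrefl refl (≤-trans le (≤-trans (≤-reflexive (size-countTrue (subsetBit S) 0 S (subsetBit-lookup S)))
    (countTrue-cover (subsetBit S) 0 (suc (suc n)) (x L.∷ y L.∷ L.[]) λ z _ gz → inPair (h z (subsetBit-member S z gz)))))
    where
    inPair : ∀ {z} → z ≡ x ⊎ z ≡ y → z LM.∈ (x L.∷ y L.∷ L.[])
    inPair (inj₁ e) = here e
    inPair (inj₂ e) = there (here e)

module RegionCounting where
  open import Defs
  open Counting
  open LeafIntervals
  open BoundaryPoints
  open Regions
  open RegionRecovery
  open RegionLists
  open BitCounting
  open Encoding
  open import Data.Nat
  open import Data.Nat.Properties
  open import Data.Fin using (Fin; toℕ; fromℕ<)
  open import Data.Fin.Properties using (toℕ-fromℕ<; any?)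
  open import Data.Fin.Subset using (_∈_; ∣_∣)
  import Data.Fin.Subset.Properties as SubP
  open import Data.Vec using (lookup)
  import Data.Vec.Properties as VP
  open import Data.List using (List; length; _∷_)
  import Data.List.Membership.Propositional as LM
  open import Data.Product using (Σ; _×_; _,_; proj₁; proj₂)
  open import Data.Sum using (inj₁; inj₂)
  open import Data.Empty
  open import Data.Bool using (Bool; true; false)
  open import Relation.Binary.PropositionalEquality
  open import Relation.Nullary
  open import Function.Bundles using (_⇔_; mk⇔; Equivalence)
  open import Data.List.Membership.DecPropositional _≟_ using () renaming (_∈?_ to _∈ℕ?_)

  consec-resp : ∀ {M M' : ℕ → Set} → (∀ z → M z ⇔' M' z) → ∀ i j → ConsecutiveIn M i j → ConsecutiveIn M' i j
  consec-resp eq i j (inj₁ h) = inj₁ λ l a b m → h l a b (proj₂ (eq l) m)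
  consec-resp eq i j (inj₂ (h1 , h2)) = inj₂ ((λ l a m → h1 l a (proj₂ (eq l) m)) , (λ l a m → h2 l a (proj₂ (eq l) m)))

  bool-ext : ∀ {b b' : Bool} → (b ≡ true → b' ≡ true) → (b' ≡ true → b ≡ true) → b ≡ b'
  bool-ext {true} {true} f g = refl
  bool-ext {true} {false} f g = sym (f refl)
  bool-ext {false} {true} f g = g refl
  bool-ext {false} {false} f g = refl

  module _ (n : ℕ) (ts : List Tree) (it : Branching ts) (e : leavesF ts ≡ suc n) (d : ℕ) (d2 : 2 ≤ d) where
    private
      E = EncodedEdge n ts
      ec = edgeSpec-root n ts e
      D = dissectionOf {n} (node ts)

    descendant-inPolygon : ∀ {us o'} → Descendant ts 0 us o' → ∀ z → z LM.∈ boundary us o' → z < suc (suc n)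
    descendant-inPolygon {us} {o'} sub z m =
      s≤s (≤-trans (proj₂ (boundary-bounds us o' z m)) (≤-trans (proj₂ (descendant-bounds sub)) (≤-reflexive e)))

    listed-isRegion : ∀ p → p LM.∈ regionsF d ts 0 → IsRegion D (toSub p) × ∣ toSub {n} p ∣ ≡ suc d
    listed-isRegion p m with regionsF-member d ts 0 p m
    ... | us , o' , sub , refl , len = (≤-trans (s≤s (s≤s (s≤s z≤n))) (≤-trans (s≤s d2) (≤-reflexive (sym sz))) , regp) , sz
      where
      bd = descendant-inPolygon sub
      S = toSub {n} (boundary us o')
      sz : ∣ S ∣ ≡ suc d
      sz = trans (size-toSub (boundary us o') (boundary-sorted us o') bd) (trans (length-boundary us o') (cong suc len))
      reg = boundary-isRegion (descendant-branching it sub) (descendant-edgeSpec it ec sub)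
      eqv = memberOf-toSub {n} (boundary us o') bd
      regp : ∀ i j → i ∈ S → j ∈ S → toℕ i < toℕ j → Edge D i j ⇔ Consec S i j
      regp i j mi mj lt = mk⇔
        (λ ed → proj₂ (consec-memberOf S i j) (consec-resp (λ z → proj₂ (eqv z) , proj₁ (eqv z)) (toℕ i) (toℕ j)
                  (proj₁ (reg (toℕ i) (toℕ j) mi' mj' lt) (proj₁ (edge-dissectionOf ts i j) ed))))
        (λ co → proj₂ (edge-dissectionOf ts i j) (proj₂ (reg (toℕ i) (toℕ j) mi' mj' lt)
                  (consec-resp eqv (toℕ i) (toℕ j) (proj₁ (consec-memberOf S i j) co))))
        where
        mi' = proj₁ (eqv (toℕ i)) (proj₁ (memberOf-fin S i) mi)
        mj' = proj₁ (eqv (toℕ j)) (proj₁ (memberOf-fin S j) mj)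

    listed-injective : ∀ p p' → p LM.∈ regionsF d ts 0 → p' LM.∈ regionsF d ts 0 → toSub {n} p ≡ toSub p' → p ≡ p'
    listed-injective p p' m m' eq with regionsF-member d ts 0 p m | regionsF-member d ts 0 p' m'
    ... | us , o' , sub , refl , _ | us' , o'' , sub' , refl , _ =
      sorted-unique _ _ (boundary-sorted us o') (boundary-sorted us' o'')
        (λ z zm → proj₁ (memberOf-toSub {n} _ (descendant-inPolygon sub') z)
                    (subst (λ S → MemberOf S z) eq (proj₂ (memberOf-toSub {n} _ (descendant-inPolygon sub) z) zm)))
        (λ z zm → proj₁ (memberOf-toSub {n} _ (descendant-inPolygon sub) z)
                    (subst (λ S → MemberOf S z) (sym eq) (proj₂ (memberOf-toSub {n} _ (descendant-inPolygon sub') z) zm)))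

    region-onℕ : ∀ S → IsRegion D S → RegionOf E (MemberOf S)
    region-onℕ S (_ , regS) i j (p , m) (q , m') lt =
      subst₂ (λ a b → E a b ⇔' ConsecutiveIn (MemberOf S) a b) (toℕ-fromℕ< p) (toℕ-fromℕ< q)
        (onFin (fromℕ< p) (fromℕ< q) m m' (subst₂ _<_ (sym (toℕ-fromℕ< p)) (sym (toℕ-fromℕ< q)) lt))
      where
      onFin : ∀ (x y : Fin (suc (suc n))) → x ∈ S → y ∈ S → toℕ x < toℕ y →
        E (toℕ x) (toℕ y) ⇔' ConsecutiveIn (MemberOf S) (toℕ x) (toℕ y)
      onFin x y mx my l =
        (λ ed → proj₁ (consec-memberOf S x y) (Equivalence.to (regS x y mx my l) (proj₂ (edge-dissectionOf ts x y) ed))) ,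
        (λ co → proj₁ (edge-dissectionOf ts x y) (Equivalence.from (regS x y mx my l) (proj₂ (consec-memberOf S x y) co)))

    recovered-toSub : ∀ S → RecoveredRegion E (MemberOf S) ts 0 → Σ (List ℕ) λ p → toSub {n} p ≡ S × Σ (List Tree) λ us → Σ ℕ λ o' →
      Descendant ts 0 us o' × p ≡ boundary us o'
    recovered-toSub S (us , o' , sub , _ , _ , eqv) = boundary us o' , Seq , us , o' , sub , refl
      where
      p = boundary us o'
      pw : ∀ x → memberB p (toℕ x) ≡ lookup S x
      pw x = bool-ext (λ t → VP.[]=⇒lookup (proj₂ (memberOf-fin S x) (proj₂ (eqv (toℕ x)) (proj₁ (dec-true (toℕ x ∈ℕ? p)) t))))
                      (λ t → proj₂ (dec-true (toℕ x ∈ℕ? p)) (proj₁ (eqv (toℕ x)) (proj₁ (memberOf-fin S x) (VP.lookup⇒[]= x S t))))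
      Seq : toSub p ≡ S
      Seq = trans (VP.tabulate-cong pw) (VP.tabulate∘lookup S)

    region-isListed : ∀ S → IsRegion D S × ∣ S ∣ ≡ suc d → Σ (List ℕ) λ p → p LM.∈ regionsF d ts 0 × toSub p ≡ S
    region-isListed S (regS , size)
      with recovered-toSub S (recover-region (leavesF ts) ≤-refl it ec (MemberOf? S) bnd (region-onℕ S regS) big (proj₁ wit) (proj₂ wit))
      where
      bnd : ∀ z → MemberOf S z → 0 ≤ z × z ≤ 0 + leavesF ts
      bnd z mz = z≤n , ≤-trans (memberOf-bound mz) (≤-reflexive (sym e))
      big : NotTwoPoints (MemberOf S)
      big = three-notTwoPoints S (≤-trans (s≤s (s≤s (s≤s z≤n))) (≤-trans (s≤s d2) (≤-reflexive (sym size))))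
      wit : Σ ℕ (MemberOf S)
      wit with any? (λ x → x SubP.∈? S)
      ... | yes (x , mx) = toℕ x , proj₁ (memberOf-fin S x) mx
      ... | no nx = ⊥-elim (big 0 0 λ { z (p , m) → ⊥-elim (nx (fromℕ< p , m)) })
    ... | p , Seq , us , o' , sub , refl = p , descendant-region d sub len , Seq
      where
      len : length us ≡ d
      len = suc-injective (trans (sym (length-boundary us o'))
        (trans (sym (size-toSub p (boundary-sorted us o') (descendant-inPolygon sub))) (trans (cong ∣_∣ Seq) size)))

  -- The regions with d + 1 ≥ 3 corners of the dissection of a tree with n + 1
  -- leaves and no unary vertices are counted by its vertices of downdegree d:
  -- toSub is a bijection from the listed boundaries onto these regions.
  regionCount : ∀ n ts → Branching ts → leavesF ts ≡ suc n → ∀ d → 2 ≤ d →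
    Count (λ S → IsRegion (dissectionOf {n} (node ts)) S × ∣ S ∣ ≡ suc d) (degCount d (node ts))
  regionCount n ts@(c ∷ cs) it e d d2 =
    count-transfer (toSub {n}) (listed-isRegion n ts it e d d2) (region-isListed n ts it e d d2)
      (listed-injective n ts it e d d2) listed
    where
    listed : Count (LM._∈ regionsF d ts 0) (degCount d (node ts))
    listed = record { elems = regionsF d ts 0 ; unique = regionsF-unique d ts 0 it ; complete = λ x → mk⇔ (λ z → z) (λ z → z)
                    ; size = regionsT-length d (≤-trans (s≤s z≤n) d2) (node ts) 0 }

module DegreeStatistics where
  open import Defs
  open LeafIntervals
  open TreeEnumeration using (children-fewer)
  open import Data.Nat
  open import Data.Nat.Properties
  open import Algebra.Properties.CommutativeSemigroup +-commutativeSemigroup using (interchange)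
  open import Data.List using (List; length; []; _∷_)
  open import Data.Product using (_×_; _,_)
  open import Data.Empty
  open import Data.Unit using (⊤; tt)
  open import Data.Bool using (if_then_else_)
  open import Relation.Binary.PropositionalEquality
  open import Relation.Nullary

  isDeg : ℕ → ℕ → ℕ
  isDeg x d = if does (x ≟ d) then 1 else 0

  isDeg-≢ : ∀ x d → x ≢ d → isDeg x d ≡ 0
  isDeg-≢ x d ne = byDecision (x ≟ d)
    where
    byDecision : (p : Dec (x ≡ d)) → (if does p then 1 else 0) ≡ 0
    byDecision (yes e) = ⊥-elim (ne e)
    byDecision (no _) = refl

  isDeg-zero : ∀ x d → isDeg x d ≡ 0 → x ≢ d
  isDeg-zero x d = byDecision (x ≟ d)
    where
    byDecision : (p : Dec (x ≡ d)) → (if does p then 1 else 0) ≡ 0 → x ≢ d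
    byDecision (yes _) ()
    byDecision (no ne) _ = ne

  mutual
    leaves-degCount0 : ∀ t → leaves t ≡ degCount 0 t
    leaves-degCount0 (node []) = refl
    leaves-degCount0 (node (c ∷ cs)) = cong₂ _+_ (leaves-degCount0 c) (leavesF-degCount0 cs)

    leavesF-degCount0 : ∀ ts → leavesF ts ≡ degCountF 0 ts
    leavesF-degCount0 [] = refl
    leavesF-degCount0 (c ∷ cs) = cong₂ _+_ (leaves-degCount0 c) (leavesF-degCount0 cs)

  mutual
    noUnary→deg1 : ∀ t → NoUnary t → degCount 1 t ≡ 0
    noUnary→deg1 (node ts) (n1 , v) = cong₂ _+_ (isDeg-≢ (length ts) 1 n1) (noUnaryF→deg1 ts v)

    noUnaryF→deg1 : ∀ ts → NoUnaryF ts → degCountF 1 ts ≡ 0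
    noUnaryF→deg1 [] v = refl
    noUnaryF→deg1 (c ∷ cs) (vc , vcs) = cong₂ _+_ (noUnary→deg1 c vc) (noUnaryF→deg1 cs vcs)

  mutual
    deg1→noUnary : ∀ t → degCount 1 t ≡ 0 → NoUnary t
    deg1→noUnary (node ts) e = isDeg-zero (length ts) 1 (m+n≡0⇒m≡0 _ e) , deg1→noUnaryF ts (m+n≡0⇒n≡0 (isDeg (length ts) 1) e)

    deg1→noUnaryF : ∀ ts → degCountF 1 ts ≡ 0 → NoUnaryF ts
    deg1→noUnaryF [] e = tt
    deg1→noUnaryF (c ∷ cs) e = deg1→noUnary c (m+n≡0⇒m≡0 _ e) , deg1→noUnaryF cs (m+n≡0⇒n≡0 (degCount 1 c) e)

  mutual
    DegreesBelow : ℕ → Tree → Set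
    DegreesBelow B (node ts) = length ts < B × DegreesBelowF B ts

    DegreesBelowF : ℕ → List Tree → Set
    DegreesBelowF B [] = ⊤
    DegreesBelowF B (c ∷ cs) = DegreesBelow B c × DegreesBelowF B cs

  mutual
    degreesBelow-mono : ∀ {B B'} t → B ≤ B' → DegreesBelow B t → DegreesBelow B' t
    degreesBelow-mono (node ts) le (l , a) = <-≤-trans l le , degreesBelowF-mono ts le a

    degreesBelowF-mono : ∀ {B B'} ts → B ≤ B' → DegreesBelowF B ts → DegreesBelowF B' ts
    degreesBelowF-mono [] le a = tt
    degreesBelowF-mono (c ∷ cs) le (a , b) = degreesBelow-mono c le a , degreesBelowF-mono cs le b

  mutual
    degreesBelow-degCount : ∀ B t → DegreesBelow B t → ∀ d → B ≤ d → degCount d t ≡ 0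
    degreesBelow-degCount B (node ts) (l , a) d le = cong₂ _+_ (isDeg-≢ (length ts) d λ e → <-irrefl e (<-≤-trans l le)) (degreesBelowF-degCount B ts a d le)

    degreesBelowF-degCount : ∀ B ts → DegreesBelowF B ts → ∀ d → B ≤ d → degCountF d ts ≡ 0
    degreesBelowF-degCount B [] a d le = refl
    degreesBelowF-degCount B (c ∷ cs) (a , b) d le = cong₂ _+_ (degreesBelow-degCount B c a d le) (degreesBelowF-degCount B cs b d le)

  children-fewerThanLeaves : ∀ ts → length ts ≤ leavesF ts
  children-fewerThanLeaves [] = z≤n
  children-fewerThanLeaves (c ∷ cs) = +-mono-≤ (leaves≥1 c) (children-fewerThanLeaves cs)

  mutual
    degreesBelow-leaves : ∀ t → DegreesBelow (suc (leaves t)) t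
    degreesBelow-leaves (node []) = s≤s z≤n , tt
    degreesBelow-leaves (node (c ∷ cs)) = s≤s (children-fewerThanLeaves (c ∷ cs)) , degreesBelowF-leaves (c ∷ cs) (c ∷ cs) ≤-refl

    degreesBelowF-leaves : ∀ ts ts0 → leavesF ts ≤ leavesF ts0 → DegreesBelowF (suc (leavesF ts0)) ts
    degreesBelowF-leaves [] ts0 le = tt
    degreesBelowF-leaves (c ∷ cs) ts0 le = degreesBelow-mono c (s≤s (≤-trans (m≤m+n _ _) le)) (degreesBelow-leaves c) ,
      degreesBelowF-leaves cs ts0 (≤-trans (m≤n+m _ _) le)

  mutual
    degreesBelow-vertices : ∀ t → DegreesBelow (vertices t) t
    degreesBelow-vertices (node ts) = s≤s (children-fewer ts _ ≤-refl) , degreesBelowF-vertices ts ts ≤-refl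

    degreesBelowF-vertices : ∀ ts ts0 → verticesF ts ≤ verticesF ts0 → DegreesBelowF (suc (verticesF ts0)) ts
    degreesBelowF-vertices [] ts0 le = tt
    degreesBelowF-vertices (c ∷ cs) ts0 le = degreesBelow-mono c (≤-trans (m≤m+n _ _) (≤-trans le (n≤1+n _))) (degreesBelow-vertices c) ,
      degreesBelowF-vertices cs ts0 (≤-trans (m≤n+m _ _) le)

  sumBelow : ℕ → (ℕ → ℕ) → ℕ
  sumBelow zero g = 0
  sumBelow (suc B) g = g 0 + sumBelow B (λ d → g (suc d))

  sumBelow-cong : ∀ B f g → (∀ d → f d ≡ g d) → sumBelow B f ≡ sumBelow B g
  sumBelow-cong zero f g h = refl
  sumBelow-cong (suc B) f g h = cong₂ _+_ (h 0) (sumBelow-cong B _ _ (λ d → h (suc d)))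

  sumBelow-+ : ∀ B f g → sumBelow B (λ d → f d + g d) ≡ sumBelow B f + sumBelow B g
  sumBelow-+ zero f g = refl
  sumBelow-+ (suc B) f g = trans (cong (f 0 + g 0 +_) (sumBelow-+ B _ _)) (interchange (f 0) (g 0) _ _)

  sumBelow-zero : ∀ B → sumBelow B (λ _ → 0) ≡ 0
  sumBelow-zero zero = refl
  sumBelow-zero (suc B) = sumBelow-zero B

  sumBelow-isDeg : ∀ B x → x < B → sumBelow B (isDeg x) ≡ 1
  sumBelow-isDeg (suc B) zero lt = cong suc (trans (sumBelow-cong B _ _ (λ d → refl)) (sumBelow-zero B))
  sumBelow-isDeg (suc B) (suc x) (s≤s lt) = sumBelow-isDeg B x lt

  -- each vertex is counted once, by its downdegree: vertices t = Σ_d r_d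
  mutual
    vertices-sum : ∀ B t → DegreesBelow B t → vertices t ≡ sumBelow B (λ d → degCount d t)
    vertices-sum B (node ts) (l , a) = sym (trans (sumBelow-+ B (isDeg (length ts)) (λ d → degCountF d ts))
      (cong₂ _+_ (sumBelow-isDeg B (length ts) l) (sym (verticesF-sum B ts a))))

    verticesF-sum : ∀ B ts → DegreesBelowF B ts → verticesF ts ≡ sumBelow B (λ d → degCountF d ts)
    verticesF-sum B [] a = sym (sumBelow-zero B)
    verticesF-sum B (c ∷ cs) (a , b) = trans (cong₂ _+_ (vertices-sum B c a) (verticesF-sum B cs b)) (sym (sumBelow-+ B _ _))

-- A tree counted by T_{r,m} is exactly a tree with n + 1
-- leaves, no unary vertices and k_j vertices with j + 1 children ("shaped by
-- k"); its dissection has type k, dissectionOf is injective on such trees, and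
-- every dissection of type k is the dissection of such a tree.
module Correspondence where
  open import Defs
  open Counting
  open LeafIntervals
  open Crossings
  open Injectivity
  open Construction
  open Regions using (Branching)
  open RegionRecovery using (branching-children; twoChildren-leaves)
  open RegionCounting
  open Encoding
  open DegreeStatistics
  open import Data.Nat
  open import Data.Nat.Properties
  open import Data.Fin as F using (Fin; toℕ; fromℕ<)
  open import Data.Fin.Properties using (toℕ<n; fromℕ<-toℕ; toℕ-fromℕ<)
  open import Data.Fin.Subset using (∣_∣)
  open import Data.Vec using (Vec; lookup; []; _∷_)
  import Data.Vec.Properties as VP
  open import Data.List using (List; []; _∷_)
  open import Data.Product using (Σ; _×_; _,_; proj₁; proj₂)
  open import Data.Empty
  open import Data.Bool using (true)
  import Data.Bool.Properties as BoolP
  open import Relation.Binary.PropositionalEquality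
  open import Relation.Nullary

  rEntry-inRange : ∀ {n} (k : Vec ℕ n) j (p : j < n) → rEntry k (suc (suc j)) ≡ lookup k (fromℕ< p)
  rEntry-inRange {n} k j p with j <? n
  ... | yes p' = refl
  ... | no np = ⊥-elim (np p)

  rEntry-outOfRange : ∀ {n} (k : Vec ℕ n) j → ¬ (j < n) → rEntry k (suc (suc j)) ≡ 0
  rEntry-outOfRange {n} k j np with j <? n
  ... | yes p = ⊥-elim (np p)
  ... | no _ = refl

  lookup-≤-sum : ∀ {n} (k : Vec ℕ n) i → lookup k i ≤ sumᵥ k
  lookup-≤-sum (x ∷ k) F.zero = m≤m+n x _
  lookup-≤-sum (x ∷ k) (F.suc i) = ≤-trans (lookup-≤-sum k i) (m≤n+m _ x)

  sumBelow-vec : ∀ {n} (k : Vec ℕ n) g → (∀ (i : Fin n) → g (toℕ i) ≡ lookup k i) → sumBelow n g ≡ sumᵥ k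
  sumBelow-vec [] g h = refl
  sumBelow-vec (x ∷ k) g h = cong₂ _+_ (h F.zero) (sumBelow-vec k (λ d → g (suc d)) (λ i → h (F.suc i)))

  degCount-rSeq : ∀ {n} (k : Vec ℕ n) m t → downdegSeq m t ≡ rSeq k m → ∀ j → j ≤ m → degCount j t ≡ rEntry k j
  degCount-rSeq k m t eq j le = begin
    degCount j t                               ≡⟨ cong (λ x → degCount x t) (sym (toℕ-fromℕ< j<)) ⟩
    degCount (toℕ (fromℕ< j<)) t               ≡⟨ sym (VP.lookup∘tabulate (λ x → degCount (toℕ x) t) (fromℕ< j<)) ⟩
    lookup (downdegSeq m t) (fromℕ< j<)        ≡⟨ cong (λ v → lookup v (fromℕ< j<)) eq ⟩
    lookup (rSeq k m) (fromℕ< j<)              ≡⟨ VP.lookup∘tabulate (λ x → rEntry k (toℕ x)) (fromℕ< j<) ⟩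
    rEntry k (toℕ (fromℕ< j<))                 ≡⟨ cong (rEntry k) (toℕ-fromℕ< j<) ⟩
    rEntry k j                                 ∎
    where
    open ≡-Reasoning
    j< : j < suc m
    j< = s≤s le

  Shaped : (n : ℕ) → Vec ℕ n → Tree → Set
  Shaped n k t = leaves t ≡ suc n × NoUnary t × (∀ (i : Fin n) → degCount (2 + toℕ i) t ≡ lookup k i)

  -- Trees counted by T_{r,m} are exactly the shaped trees: r₀ = n + 1 counts the
  -- leaves, r₁ = 0 excludes unary vertices, and r_{j+1} = k_j; conversely the
  -- vertex count of a shaped tree is (n + 1) + 0 + Σ_j k_j = m + 1.
  treeWith→shaped : ∀ {n} → 1 ≤ n → (k : Vec ℕ n) → ∀ t →
    TreeWith (n + numParts k) (rSeq k (n + numParts k)) t → Shaped n k t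
  treeWith→shaped {n} n1 k t (vt , dt) =
    trans (leaves-degCount0 t) (degCount-rSeq k m t dt 0 z≤n) ,
    deg1→noUnary t (degCount-rSeq k m t dt 1 (≤-trans n1 (m≤m+n n K))) , degrees
    where
    K = numParts k
    m = n + K
    degrees : ∀ (i : Fin n) → degCount (2 + toℕ i) t ≡ lookup k i
    degrees i with 2 + toℕ i ≤? m
    ... | yes le = trans (degCount-rSeq k m t dt (2 + toℕ i) le)
                     (trans (rEntry-inRange k (toℕ i) (toℕ<n i)) (cong (lookup k) (fromℕ<-toℕ i (toℕ<n i))))
    ... | no nle = trans (degreesBelow-degCount (vertices t) t (degreesBelow-vertices t) (2 + toℕ i)
                           (≤-trans (≤-reflexive vt) (≰⇒> nle)))
                         (sym (n≤0⇒n≡0 (≤-trans (lookup-≤-sum k i) noParts)))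
      where
      -- 2 + i > n + K forces K = 0
      noParts : K ≤ 0
      noParts = +-cancelˡ-≤ n K 0 (≤-trans (s≤s⁻¹ (≤-trans (≰⇒> nle) (s≤s (toℕ<n i)))) (≤-reflexive (sym (+-identityʳ n))))

  shaped→treeWith : ∀ {n} (k : Vec ℕ n) t → Shaped n k t →
    TreeWith (n + numParts k) (rSeq k (n + numParts k)) t
  shaped→treeWith {n} k t (lt , nu , degrees) = vert , VP.tabulate-cong (λ x → degAll (toℕ x))
    where
    degAll : ∀ j → degCount j t ≡ rEntry k j
    degAll zero = trans (sym (leaves-degCount0 t)) lt
    degAll (suc zero) = noUnary→deg1 t nu
    degAll (suc (suc j)) = degAbove (j <? n)
      where
      degAbove : Dec (j < n) → degCount (2 + j) t ≡ rEntry k (2 + j)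
      degAbove (yes p) = trans (cong (λ x → degCount (2 + x) t) (sym (toℕ-fromℕ< p)))
                               (trans (degrees (fromℕ< p)) (sym (rEntry-inRange k j p)))
      degAbove (no np) = trans (degreesBelow-degCount (suc (leaves t)) t (degreesBelow-leaves t) (2 + j)
                                 (≤-trans (s≤s (≤-reflexive lt)) (s≤s (s≤s (≮⇒≥ np)))))
                               (sym (rEntry-outOfRange k j np))
    vert : vertices t ≡ suc (n + numParts k)
    vert = begin
      vertices t                                         ≡⟨ vertices-sum (suc (leaves t)) t (degreesBelow-leaves t) ⟩
      sumBelow (suc (leaves t)) (λ d → degCount d t)     ≡⟨ cong (λ B → sumBelow (suc B) (λ d → degCount d t)) lt ⟩
      degCount 0 t + (degCount 1 t + sumBelow n (λ d → degCount (2 + d) t))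
        ≡⟨ cong₂ _+_ (degAll 0) (cong₂ _+_ (degAll 1) (sumBelow-vec k (λ d → degCount (2 + d) t) degrees)) ⟩
      suc (n + numParts k)                               ∎
      where open ≡-Reasoning

  root-children : ∀ n → 1 ≤ n → ∀ t → NoUnary t → leaves t ≡ suc n →
    Σ (List Tree) λ ts → t ≡ node ts × Branching ts × leavesF ts ≡ suc n
  root-children (suc n) _ (node []) v ()
  root-children n _ (node (c ∷ cs)) v e = c ∷ cs , refl , branching-children {c} {cs} v , e

  dissectionOf-isDissection : ∀ n ts → Branching ts → leavesF ts ≡ suc n → IsDissection n (dissectionOf {n} (node ts))
  dissectionOf-isDissection n ts it e = diag , nc
    where
    v : NoUnary (node ts)
    v = (λ l → <-irrefl (sym l) (proj₂ it)) , proj₁ it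
    lt : leaves (node ts) ≡ suc n
    lt = trans (leaves-node ts (≤-trans (s≤s z≤n) (twoChildren-leaves ts (proj₂ it)))) e
    diag : ∀ i j → Has (dissectionOf {n} (node ts)) i j → IsDiagonal n i j
    diag i j h with gen-bounds v (proj₁ (has-dissectionOf (node ts) i j) h)
    ... | _ , two , _ , nsp = two , λ { (p , q) → nsp (p , trans q (sym lt)) }
    nc : ∀ a b c d → Has (dissectionOf {n} (node ts)) a b → Has (dissectionOf {n} (node ts)) c d → ¬ Cross a b c d
    nc a b c d h h' cr = gen-noncrossing v (proj₁ (has-dissectionOf (node ts) a b) h) (proj₁ (has-dissectionOf (node ts) c d) h') cr

  regionCount-ofType : ∀ n ts → Branching ts → leavesF ts ≡ suc n → ∀ (i : Fin n) →
    Count (λ S → IsRegion (dissectionOf {n} (node ts)) S × ∣ S ∣ ≡ toℕ i + 3) (degCount (2 + toℕ i) (node ts))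
  regionCount-ofType n ts it e i = count-cong
    (λ S x → proj₁ x , trans (proj₂ x) (+-comm 3 (toℕ i))) (λ S x → proj₁ x , trans (proj₂ x) (+-comm (toℕ i) 3))
    (regionCount n ts it e (2 + toℕ i) (s≤s (s≤s z≤n)))

  dissectionOf-ofType : ∀ {n} → 1 ≤ n → (k : Vec ℕ n) → ∀ t → Shaped n k t → DissectionOfType n k (dissectionOf t)
  dissectionOf-ofType {n} n1 k t (lt , nu , degrees) with root-children n n1 t nu lt
  ... | ts , refl , it , lts = dissectionOf-isDissection n ts it lts ,
    λ i → subst (Count _) (degrees i) (regionCount-ofType n ts it lts i)

  dissectionOf-gen : ∀ {n} t t' → NoUnary t → leaves t ≡ suc n → dissectionOf {n} t ≡ dissectionOf t' → Sub₂ (Gen t 0) (Gen t' 0)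
  dissectionOf-gen {n} t t' v l e i j g = subst₂ (Gen t' 0) (toℕ-fromℕ< p) (toℕ-fromℕ< q)
      (proj₁ (has-dissectionOf t' (fromℕ< p) (fromℕ< q))
        (subst (λ D → Has D (fromℕ< p) (fromℕ< q)) e (proj₂ (has-dissectionOf t (fromℕ< p) (fromℕ< q)) g')))
    where
    bd = gen-bounds v g
    q : j < suc (suc n)
    q = s≤s (≤-trans (proj₁ (proj₂ (proj₂ bd))) (≤-reflexive l))
    p : i < suc (suc n)
    p = <-trans (≤-trans (n≤1+n _) (proj₁ (proj₂ bd))) q
    g' : Gen t 0 (toℕ (fromℕ< p)) (toℕ (fromℕ< q))
    g' = subst₂ (Gen t 0) (sym (toℕ-fromℕ< p)) (sym (toℕ-fromℕ< q)) g

  dissectionOf-injective : ∀ {n} t t' → leaves t ≡ suc n → NoUnary t → leaves t' ≡ suc n → NoUnary t' →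
    dissectionOf {n} t ≡ dissectionOf t' → t ≡ t'
  dissectionOf-injective t t' lt vt lt' vt' eq =
    gen-injective t t' 0 vt vt' (trans lt (sym lt')) (dissectionOf-gen t t' vt lt eq) (dissectionOf-gen t' t vt' lt' (sym eq))

  DiagonalsOf : (n : ℕ) → Diagonals n → ℕ → ℕ → Set
  DiagonalsOf n D i j = Σ (i < suc (suc n)) λ p → Σ (j < suc (suc n)) λ q → Has D (fromℕ< p) (fromℕ< q)

  diagonalsOf-noncrossing : ∀ n D → IsDissection n D → NoncrossingSet (DiagonalsOf n D)
  diagonalsOf-noncrossing n D dis = record { dec = dec ; diag = diag ; nc = nc }
    where
    dec : ∀ i j → Dec (DiagonalsOf n D i j)
    dec i j with i <? suc (suc n) | j <? suc (suc n)
    ... | no np | _ = no λ x → np (proj₁ x)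
    ... | yes p | no nq = no λ x → nq (proj₁ (proj₂ x))
    ... | yes p | yes q with lookup (lookup D (fromℕ< p)) (fromℕ< q) BoolP.≟ true
    ... | yes h = yes (p , q , h)
    ... | no nh = no λ x → nh (proj₂ (proj₂ x))
    diag : ∀ {i j} → DiagonalsOf n D i j → 2 + i ≤ j
    diag (p , q , h) = subst₂ (λ a b → suc a < b) (toℕ-fromℕ< p) (toℕ-fromℕ< q) (proj₁ (proj₁ dis _ _ h))
    nc : ∀ {i j i' j'} → DiagonalsOf n D i j → DiagonalsOf n D i' j' → ¬ (i < i' × i' < j × j < j')
    nc (p , q , h) (p' , q' , h') (a , b , c) = proj₂ dis _ _ _ _ h h'
      (subst₂ _<_ (sym (toℕ-fromℕ< p)) (sym (toℕ-fromℕ< p')) a ,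
       subst₂ _<_ (sym (toℕ-fromℕ< p')) (sym (toℕ-fromℕ< q)) b ,
       subst₂ _<_ (sym (toℕ-fromℕ< q)) (sym (toℕ-fromℕ< q')) c)

  module _ {n : ℕ} (n1 : 1 ≤ n) (D : Diagonals n) (dis : IsDissection n D) where
    private
      built : ForestFor (DiagonalsOf n D) 0 (suc n)
      built = forestFor (suc n) (DiagonalsOf n D) (diagonalsOf-noncrossing n D dis) 0 (suc n) (s≤s z≤n) ≤-refl
      ts = proj₁ built
      vts = proj₁ (proj₂ built)
      lts = proj₁ (proj₂ (proj₂ built))
      realises = proj₁ (proj₂ (proj₂ (proj₂ built)))
      complete = proj₂ (proj₂ (proj₂ (proj₂ built)))

    treeOf : Tree
    treeOf = node ts

    -- the root is not unary, since {0, n + 1} is a side, not a diagonal of D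
    treeOf-noUnary : NoUnary treeOf
    treeOf-noUnary = forest-notSingle (DiagonalsOf n D) 0 (suc n) ts (s≤s n1) lts
      (λ i j lo hi g → realises i j lo hi g , notRoot (realises i j lo hi g)) , vts
      where
      notRoot : ∀ {i j} → DiagonalsOf n D i j → ¬ (i ≡ 0 × j ≡ suc n)
      notRoot (p , q , h) (e1 , e2) = proj₂ (proj₁ dis _ _ h) (trans (toℕ-fromℕ< p) e1 , trans (toℕ-fromℕ< q) e2)

    treeOf-leaves : leaves treeOf ≡ suc n
    treeOf-leaves = trans (leaves-node ts (≤-trans (s≤s z≤n) (≤-reflexive (sym lts)))) lts

    treeOf-branching : Branching ts
    treeOf-branching with root-children n n1 treeOf treeOf-noUnary treeOf-leaves
    ... | _ , refl , it , _ = it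

    dissectionOf-treeOf : dissectionOf treeOf ≡ D
    dissectionOf-treeOf = trans (VP.tabulate-cong (λ i → trans (VP.tabulate-cong (λ j → entry i j)) (VP.tabulate∘lookup (lookup D i))))
                                (VP.tabulate∘lookup D)
      where
      entry : ∀ i j → Relation.Nullary.does (decGen treeOf 0 (toℕ i) (toℕ j)) ≡ lookup (lookup D i) j
      entry i j = bool-ext to from
        where
        to : does (decGen treeOf 0 (toℕ i) (toℕ j)) ≡ true → lookup (lookup D i) j ≡ true
        to x with Gen→GenForest (proj₁ (dec-true (decGen treeOf 0 (toℕ i) (toℕ j))) x)
        ... | gl with realises (toℕ i) (toℕ j) z≤n (≤-trans (proj₂ (genForest-bounds vts gl)) (≤-reflexive lts)) gl
        ... | p , q , h = subst₂ (Has D) (fromℕ<-toℕ i p) (fromℕ<-toℕ j q) h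
        from : lookup (lookup D i) j ≡ true → does (decGen treeOf 0 (toℕ i) (toℕ j)) ≡ true
        from y = proj₂ (dec-true (decGen treeOf 0 (toℕ i) (toℕ j))) (GenForest→Gen (complete (toℕ i) (toℕ j) z≤n (s≤s⁻¹ (toℕ<n j))
          (toℕ<n i , toℕ<n j , subst₂ (Has D) (sym (fromℕ<-toℕ i (toℕ<n i))) (sym (fromℕ<-toℕ j (toℕ<n j))) y)))

    -- if D has type k, its tree is shaped by k: both count the same regions
    treeOf-shaped : (k : Vec ℕ n) → HasType n k D → Shaped n k treeOf
    treeOf-shaped k ty = treeOf-leaves , treeOf-noUnary , λ i →
      count-unique (subst (λ D' → Count (λ S → IsRegion D' S × ∣ S ∣ ≡ toℕ i + 3) (degCount (2 + toℕ i) treeOf))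
                          dissectionOf-treeOf (regionCount-ofType n ts treeOf-branching lts i))
                   (ty i)

open Counting using (count-transfer)
open TreeEnumeration using (count-trees)
open Encoding using (dissectionOf)
open Correspondence

-- The main theorem.
theorem1p7 : (n : ℕ) → 1 ≤ n → (k : Vec ℕ n) → IsPartition n k →
    Σ ℕ (λ c → Count (DissectionOfType n k) c ×
    Count (TreeWith (n + numParts k) (rSeq k (n + numParts k))) c)
theorem1p7 n n1 k _ with count-trees (n + numParts k) (rSeq k (n + numParts k))
... | c , trees = c , count-transfer dissectionOf toDissection fromDissection injective trees , trees
  where
  m : ℕ
  m = n + numParts k
  toDissection : ∀ t → TreeWith m (rSeq k m) t → DissectionOfType n k (dissectionOf t)
  toDissection t tw = dissectionOf-ofType n1 k t (treeWith→shaped n1 k t tw)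
  fromDissection : ∀ D → DissectionOfType n k D → Σ Tree λ t → TreeWith m (rSeq k m) t × dissectionOf t ≡ D
  fromDissection D (dis , ty) =
    treeOf n1 D dis , shaped→treeWith k (treeOf n1 D dis) (treeOf-shaped n1 D dis k ty) , dissectionOf-treeOf n1 D dis
  injective : ∀ t t' → TreeWith m (rSeq k m) t → TreeWith m (rSeq k m) t' → dissectionOf t ≡ dissectionOf t' → t ≡ t'
  injective t t' tw tw' with treeWith→shaped n1 k t tw | treeWith→shaped n1 k t' tw'
  ... | lt , vt , _ | lt' , vt' , _ = dissectionOf-injective t t' lt vt lt' vt'
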